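{- For every integer $n\ge 6$ there exists an $(n,3)$ circuit code of length $N$ satisfying $32\cdot 3^{(n-8)/3}\le N\le \frac{24}{22}\cdot 32\cdot 3^{(n-8)/3}$.
   Context: $I(n)$ is the $n$-dimensional hypercube graph on binary vectors of length $n$, adjacency meaning difference in exactly one coordinate. An induced subgraph $C$ of $I(n)$ is an $(n,k)$ circuit code if $C$ is a cycle and for all vertices $x,x'$ of $C$ with Hamming distance $d_{I(n)}(x,x')<k$, the shortest-path distance between $x$ and $x'$ in $C$ equals $d_{I(n)}(x,x')$. Its length is its number of vertices. -}

module Defs where

open import Data.Nat using (ℕ; zero; suc; _+_; _*_; _∸_; _^_; _≤_; _<_; _⊓_; ∣_-_∣)
open import Data.Bool using (Bool; true; false; if_then_else_)
open import Data.Vec using (Vec; []; _∷_)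
open import Data.Fin using (Fin; toℕ)
open import Data.Product using (_×_; Σ)
open import Relation.Binary.PropositionalEquality using (_≡_)
open import Function.Definitions using (Injective)

Vertex : ℕ → Set
Vertex n = Vec Bool n

-- Hamming distance d_{I(n)} (= graph distance in I(n)).
hamming : ∀ {n} → Vertex n → Vertex n → ℕ
hamming [] [] = 0
hamming (a ∷ u) (b ∷ v) = (if xor a b then 1 else 0) + hamming u v
  where
  xor : Bool → Bool → Bool
  xor true  true  = false
  xor true  false = true
  xor false true  = true
  xor false false = false

Adjacent : ∀ {n} → Vertex n → Vertex n → Set
Adjacent x y = hamming x y ≡ 1

cycDist : ∀ {N} → Fin N → Fin N → ℕ
cycDist {N} i j = ∣ toℕ i - toℕ j ∣ ⊓ (N ∸ ∣ toℕ i - toℕ j ∣)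

IsInducedCycle : ∀ {n} (N : ℕ) → (Fin N → Vertex n) → Set
IsInducedCycle {n} N x =
  (3 ≤ N) × Injective _≡_ _≡_ x ×
  (∀ i j → (Adjacent (x i) (x j) → cycDist i j ≡ 1) × (cycDist i j ≡ 1 → Adjacent (x i) (x j)))

IsCircuitCode : (n k N : ℕ) → (Fin N → Vertex n) → Set
IsCircuitCode n k N x =
  IsInducedCycle N x ×
  (∀ i j → hamming (x i) (x j) < k → cycDist i j ≡ hamming (x i) (x j))

module Submission where

-- The lengths come from a tripling construction: a *triplable* code walk
-- of length N in dimension n (one that ends by flipping three coordinates
-- P, Q, R back to 0, with a few local distance conditions) yields a
-- triplable code walk of length 3N in dimension n + 3, made of three
-- translated, tagged copies of the original.  Starting from triplable
-- walks of lengths 32, 48, 72 in dimensions 8, 9, 10, and code walks of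
-- lengths 16, 24 in dimensions 6, 7 (all checked by evaluation), every
-- dimension n ≥ 6 is reached; the length bounds, with cube roots cleared,
-- are checked on the base cases and scale by 27 under tripling.

open import Defs
open import Data.Nat
open import Data.Nat.Properties
open import Data.Nat.Tactic.RingSolver using (solve-∀)
open import Data.Bool using (Bool; true; false; _xor_; _∧_; T)
open import Data.Bool.Properties using (xor-assoc; xor-comm; xor-same; xor-identityˡ; xor-identityʳ; T-∧)
open import Data.Vec using (Vec; []; _∷_; replicate; zipWith; _++_; lookup)
open import Data.Vec.Properties using (zipWith-assoc; zipWith-comm; zipWith-identityˡ; zipWith-identityʳ; lookup-zipWith; lookup-replicate)
open import Data.List using (List; []; _∷_)
open import Data.Fin using (Fin; zero; suc; toℕ; #_)
open import Data.Fin.Properties using (toℕ-injective; toℕ<n)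
open import Data.Product using (Σ; _×_; _,_; proj₁; proj₂)
open import Function.Bundles using (Equivalence)
open import Data.Sum using (_⊎_; inj₁; inj₂)
open import Data.Empty using (⊥-elim)
open import Data.Unit using (tt)
open import Relation.Nullary using (¬_; yes; no; Dec)
open import Relation.Binary.PropositionalEquality
open import Relation.Binary.Definitions using (tri<; tri≈; tri>)

-- Hamming distance is the weight of the xor, which makes
-- it translation invariant and gives the triangle inequality.

infixl 6 _⊕_
_⊕_ : ∀ {n} → Vec Bool n → Vec Bool n → Vec Bool n
_⊕_ = zipWith _xor_

zeros : ∀ {n} → Vec Bool n
zeros {n} = replicate n false

e : ∀ {n} → Fin n → Vec Bool n
e zero = true ∷ zeros
e (suc i) = false ∷ e i

weight : ∀ {n} → Vec Bool n → ℕ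
weight [] = 0
weight (true ∷ u) = suc (weight u)
weight (false ∷ u) = weight u

⊕-assoc : ∀ {n} (u v w : Vec Bool n) → (u ⊕ v) ⊕ w ≡ u ⊕ (v ⊕ w)
⊕-assoc = zipWith-assoc xor-assoc

⊕-comm : ∀ {n} (u v : Vec Bool n) → u ⊕ v ≡ v ⊕ u
⊕-comm = zipWith-comm xor-comm

⊕-identityˡ : ∀ {n} (u : Vec Bool n) → zeros ⊕ u ≡ u
⊕-identityˡ = zipWith-identityˡ xor-identityˡ

⊕-identityʳ : ∀ {n} (u : Vec Bool n) → u ⊕ zeros ≡ u
⊕-identityʳ = zipWith-identityʳ xor-identityʳ

⊕-self : ∀ {n} (u : Vec Bool n) → u ⊕ u ≡ zeros
⊕-self [] = refl
⊕-self (a ∷ u) = cong₂ _∷_ (xor-same a) (⊕-self u)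

⊕-cancelʳ : ∀ {n} (u v : Vec Bool n) → (u ⊕ v) ⊕ v ≡ u
⊕-cancelʳ u v = begin
  (u ⊕ v) ⊕ v  ≡⟨ ⊕-assoc u v v ⟩
  u ⊕ (v ⊕ v)  ≡⟨ cong (u ⊕_) (⊕-self v) ⟩
  u ⊕ zeros    ≡⟨ ⊕-identityʳ u ⟩
  u            ∎
  where open ≡-Reasoning

⊕-cancelˡ : ∀ {n} (u v : Vec Bool n) → u ⊕ (u ⊕ v) ≡ v
⊕-cancelˡ u v = begin
  u ⊕ (u ⊕ v)  ≡⟨ sym (⊕-assoc u u v) ⟩
  (u ⊕ u) ⊕ v  ≡⟨ cong (_⊕ v) (⊕-self u) ⟩
  zeros ⊕ v    ≡⟨ ⊕-identityˡ v ⟩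
  v            ∎
  where open ≡-Reasoning

⊕-swap : ∀ {n} (u v w : Vec Bool n) → (u ⊕ v) ⊕ w ≡ (u ⊕ w) ⊕ v
⊕-swap u v w = begin
  (u ⊕ v) ⊕ w  ≡⟨ ⊕-assoc u v w ⟩
  u ⊕ (v ⊕ w)  ≡⟨ cong (u ⊕_) (⊕-comm v w) ⟩
  u ⊕ (w ⊕ v)  ≡⟨ ⊕-assoc u w v ⟨
  (u ⊕ w) ⊕ v  ∎
  where open ≡-Reasoning

⊕-translate : ∀ {n} (u v w : Vec Bool n) → (u ⊕ w) ⊕ (v ⊕ w) ≡ u ⊕ v
⊕-translate u v w = begin
  (u ⊕ w) ⊕ (v ⊕ w)  ≡⟨ cong ((u ⊕ w) ⊕_) (⊕-comm v w) ⟩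
  (u ⊕ w) ⊕ (w ⊕ v)  ≡⟨ ⊕-assoc u w (w ⊕ v) ⟩
  u ⊕ (w ⊕ (w ⊕ v))  ≡⟨ cong (u ⊕_) (⊕-cancelˡ w v) ⟩
  u ⊕ v              ∎
  where open ≡-Reasoning

hamming≡weight : ∀ {n} (u v : Vec Bool n) → hamming u v ≡ weight (u ⊕ v)
hamming≡weight [] [] = refl
hamming≡weight (true ∷ u) (true ∷ v) = hamming≡weight u v
hamming≡weight (true ∷ u) (false ∷ v) = cong suc (hamming≡weight u v)
hamming≡weight (false ∷ u) (true ∷ v) = cong suc (hamming≡weight u v)
hamming≡weight (false ∷ u) (false ∷ v) = hamming≡weight u v

weight-zeros : ∀ n → weight (zeros {n}) ≡ 0
weight-zeros zero = refl
weight-zeros (suc n) = weight-zeros n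

weight-e : ∀ {n} (i : Fin n) → weight (e i) ≡ 1
weight-e {suc n} zero = cong suc (weight-zeros n)
weight-e (suc i) = weight-e i

weight-⊕ : ∀ {n} (u v : Vec Bool n) → weight (u ⊕ v) ≤ weight u + weight v
weight-⊕ [] [] = z≤n
weight-⊕ (true ∷ u) (true ∷ v) = ≤-trans (weight-⊕ u v) (≤-trans (+-monoʳ-≤ (weight u) (n≤1+n (weight v))) (n≤1+n _))
weight-⊕ (true ∷ u) (false ∷ v) = s≤s (weight-⊕ u v)
weight-⊕ (false ∷ u) (true ∷ v) = ≤-trans (s≤s (weight-⊕ u v)) (≤-reflexive (sym (+-suc (weight u) (weight v))))
weight-⊕ (false ∷ u) (false ∷ v) = weight-⊕ u v

hamming-sym : ∀ {n} (u v : Vec Bool n) → hamming u v ≡ hamming v u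
hamming-sym u v = begin
  hamming u v     ≡⟨ hamming≡weight u v ⟩
  weight (u ⊕ v)  ≡⟨ cong weight (⊕-comm u v) ⟩
  weight (v ⊕ u)  ≡⟨ hamming≡weight v u ⟨
  hamming v u     ∎
  where open ≡-Reasoning

hamming-self : ∀ {n} (u : Vec Bool n) → hamming u u ≡ 0
hamming-self {n} u = begin
  hamming u u     ≡⟨ hamming≡weight u u ⟩
  weight (u ⊕ u)  ≡⟨ cong weight (⊕-self u) ⟩
  weight (zeros {n}) ≡⟨ weight-zeros n ⟩
  0               ∎
  where open ≡-Reasoning

hamming-shift : ∀ {n} (u δ : Vec Bool n) → hamming u (u ⊕ δ) ≡ weight δ
hamming-shift u δ = trans (hamming≡weight u (u ⊕ δ)) (cong weight (⊕-cancelˡ u δ))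

hamming-flip : ∀ {n} (u : Vec Bool n) (i : Fin n) → hamming u (u ⊕ e i) ≡ 1
hamming-flip u i = trans (hamming-shift u (e i)) (weight-e i)

hamming-translate : ∀ {n} (u v w : Vec Bool n) → hamming (u ⊕ w) (v ⊕ w) ≡ hamming u v
hamming-translate u v w = begin
  hamming (u ⊕ w) (v ⊕ w)     ≡⟨ hamming≡weight (u ⊕ w) (v ⊕ w) ⟩
  weight ((u ⊕ w) ⊕ (v ⊕ w))  ≡⟨ cong weight (⊕-translate u v w) ⟩
  weight (u ⊕ v)              ≡⟨ hamming≡weight u v ⟨
  hamming u v                 ∎
  where open ≡-Reasoning

hamming-move : ∀ {n} (u v δ : Vec Bool n) → hamming (u ⊕ δ) v ≡ hamming u (v ⊕ δ)
hamming-move u v δ = begin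
  hamming (u ⊕ δ) v              ≡⟨ cong (hamming (u ⊕ δ)) (⊕-cancelʳ v δ) ⟨
  hamming (u ⊕ δ) ((v ⊕ δ) ⊕ δ)  ≡⟨ hamming-translate u (v ⊕ δ) δ ⟩
  hamming u (v ⊕ δ)              ∎
  where open ≡-Reasoning

hamming-triangle : ∀ {n} (u v w : Vec Bool n) → hamming u w ≤ hamming u v + hamming v w
hamming-triangle u v w = begin
  hamming u w                ≡⟨ hamming≡weight u w ⟩
  weight (u ⊕ w)             ≡⟨ cong weight (⊕-translate u w v) ⟨
  weight ((u ⊕ v) ⊕ (w ⊕ v)) ≤⟨ weight-⊕ (u ⊕ v) (w ⊕ v) ⟩
  weight (u ⊕ v) + weight (w ⊕ v)
    ≡⟨ cong₂ _+_ (sym (hamming≡weight u v)) (trans (sym (hamming≡weight w v)) (hamming-sym w v)) ⟩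
  hamming u v + hamming v w  ∎
  where open ≤-Reasoning

hamming-lower : ∀ {n} (a a' b : Vec Bool n) k r →
  k + r ≤ hamming a b → hamming a a' ≤ k → r ≤ hamming a' b
hamming-lower a a' b k r far close = +-cancelˡ-≤ k _ _ (begin
  k + r                        ≤⟨ far ⟩
  hamming a b                  ≤⟨ hamming-triangle a a' b ⟩
  hamming a a' + hamming a' b  ≤⟨ +-monoˡ-≤ (hamming a' b) close ⟩
  k + hamming a' b             ∎)
  where open ≤-Reasoning

hamming-++ : ∀ {k n} (a c : Vec Bool k) (b d : Vec Bool n) →
  hamming (a ++ b) (c ++ d) ≡ hamming a c + hamming b d
hamming-++ [] [] b d = refl
hamming-++ (true ∷ a) (true ∷ c) b d = hamming-++ a c b d
hamming-++ (true ∷ a) (false ∷ c) b d = cong suc (hamming-++ a c b d)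
hamming-++ (false ∷ a) (true ∷ c) b d = cong suc (hamming-++ a c b d)
hamming-++ (false ∷ a) (false ∷ c) b d = hamming-++ a c b d

differ⇒hamming≥1 : ∀ {n} (u v : Vec Bool n) (i : Fin n) →
  lookup (u ⊕ v) i ≡ true → 1 ≤ hamming u v
differ⇒hamming≥1 u v i eq = subst (1 ≤_) (sym (hamming≡weight u v)) (weight≥1 (u ⊕ v) i eq)
  where
  weight≥1 : ∀ {n} (w : Vec Bool n) (i : Fin n) → lookup w i ≡ true → 1 ≤ weight w
  weight≥1 (true ∷ w) i _ = s≤s z≤n
  weight≥1 (false ∷ w) (suc i) eq = weight≥1 w i eq

weight-e⊕e : ∀ {n} (a b : Fin n) → ¬ a ≡ b → weight (e a ⊕ e b) ≡ 2
weight-e⊕e {suc n} zero zero a≢b = ⊥-elim (a≢b refl)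
weight-e⊕e {suc n} zero (suc b) _ = cong suc (trans (cong weight (⊕-identityˡ (e b))) (weight-e b))
weight-e⊕e {suc n} (suc a) zero _ = cong suc (trans (cong weight (⊕-identityʳ (e a))) (weight-e a))
weight-e⊕e (suc a) (suc b) a≢b = weight-e⊕e a b (λ eq → a≢b (cong suc eq))

lookup-⊕ : ∀ {n} (u v : Vec Bool n) (i : Fin n) → lookup (u ⊕ v) i ≡ lookup u i xor lookup v i
lookup-⊕ u v i = lookup-zipWith _xor_ i u v

lookup-e-same : ∀ {n} (i : Fin n) → lookup (e i) i ≡ true
lookup-e-same zero = refl
lookup-e-same (suc i) = lookup-e-same i

lookup-e-other : ∀ {n} (i j : Fin n) → ¬ i ≡ j → lookup (e j) i ≡ false
lookup-e-other zero zero i≢j = ⊥-elim (i≢j refl)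
lookup-e-other zero (suc j) _ = refl
lookup-e-other (suc i) zero _ = lookup-replicate i false
lookup-e-other (suc i) (suc j) i≢j = lookup-e-other i j (λ eq → i≢j (cong suc eq))

lookup-extensional : ∀ {n} (u v : Vec Bool n) → (∀ i → lookup u i ≡ lookup v i) → u ≡ v
lookup-extensional [] [] _ = refl
lookup-extensional (a ∷ u) (b ∷ v) same = cong₂ _∷_ (same zero) (lookup-extensional u v (λ i → same (suc i)))

-- An expression over k generators is normalised to its vector
-- of coefficients in (ℤ/2)ᵏ; two expressions with the same coefficients
-- denote the same vector for every choice of generators, because every
-- coordinate of the value is the parity of the selected generator coordinates.

infixl 6 _⊕ᵉ_
data Expr (k : ℕ) : Set where
  var : Fin k → Expr k
  ∅ : Expr k
  _⊕ᵉ_ : Expr k → Expr k → Expr k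

⟦_⟧ : ∀ {k n} → Expr k → (Fin k → Vec Bool n) → Vec Bool n
⟦ var j ⟧ ρ = ρ j
⟦ ∅ ⟧ ρ = zeros
⟦ f ⊕ᵉ g ⟧ ρ = ⟦ f ⟧ ρ ⊕ ⟦ g ⟧ ρ

coefficients : ∀ {k} → Expr k → Vec Bool k
coefficients (var j) = e j
coefficients ∅ = zeros
coefficients (f ⊕ᵉ g) = coefficients f ⊕ coefficients g

inner : ∀ {k} → Vec Bool k → (Fin k → Bool) → Bool
inner [] σ = false
inner (true ∷ u) σ = σ zero xor inner u (λ j → σ (suc j))
inner (false ∷ u) σ = inner u (λ j → σ (suc j))

private
  xor-shared : ∀ s x y → (s xor x) xor (s xor y) ≡ x xor y
  xor-shared false x y = refl
  xor-shared true false false = refl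
  xor-shared true false true = refl
  xor-shared true true false = refl
  xor-shared true true true = refl

  xor-swap : ∀ s x y → x xor (s xor y) ≡ s xor (x xor y)
  xor-swap s x y = trans (sym (xor-assoc x s y)) (trans (cong (_xor y) (xor-comm x s)) (xor-assoc s x y))

inner-⊕ : ∀ {k} (u v : Vec Bool k) σ → inner (u ⊕ v) σ ≡ inner u σ xor inner v σ
inner-⊕ [] [] σ = refl
inner-⊕ (true ∷ u) (true ∷ v) σ =
  trans (inner-⊕ u v _) (sym (xor-shared (σ zero) (inner u _) (inner v _)))
inner-⊕ (true ∷ u) (false ∷ v) σ =
  trans (cong (σ zero xor_) (inner-⊕ u v _)) (sym (xor-assoc (σ zero) (inner u _) (inner v _)))
inner-⊕ (false ∷ u) (true ∷ v) σ =
  trans (cong (σ zero xor_) (inner-⊕ u v _)) (sym (xor-swap (σ zero) (inner u _) (inner v _)))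
inner-⊕ (false ∷ u) (false ∷ v) σ = inner-⊕ u v _

inner-zeros : ∀ k σ → inner (zeros {k}) σ ≡ false
inner-zeros zero σ = refl
inner-zeros (suc k) σ = inner-zeros k _

inner-e : ∀ {k} (j : Fin k) σ → inner (e j) σ ≡ σ j
inner-e {suc k} zero σ = trans (cong (σ zero xor_) (inner-zeros k _)) (xor-identityʳ (σ zero))
inner-e (suc j) σ = inner-e j _

inner-cong : ∀ {k} (u : Vec Bool k) {σ σ' : Fin k → Bool} → (∀ j → σ j ≡ σ' j) → inner u σ ≡ inner u σ'
inner-cong [] same = refl
inner-cong (true ∷ u) same = cong₂ _xor_ (same zero) (inner-cong u (λ j → same (suc j)))
inner-cong (false ∷ u) same = inner-cong u (λ j → same (suc j))

lookup-⟦⟧ : ∀ {k n} (f : Expr k) (ρ : Fin k → Vec Bool n) (i : Fin n) →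
  lookup (⟦ f ⟧ ρ) i ≡ inner (coefficients f) (λ j → lookup (ρ j) i)
lookup-⟦⟧ (var j) ρ i = sym (inner-e j _)
lookup-⟦⟧ {k} ∅ ρ i = trans (lookup-replicate i false) (sym (inner-zeros k _))
lookup-⟦⟧ (f ⊕ᵉ g) ρ i = begin
  lookup (⟦ f ⟧ ρ ⊕ ⟦ g ⟧ ρ) i                    ≡⟨ lookup-⊕ (⟦ f ⟧ ρ) (⟦ g ⟧ ρ) i ⟩
  lookup (⟦ f ⟧ ρ) i xor lookup (⟦ g ⟧ ρ) i       ≡⟨ cong₂ _xor_ (lookup-⟦⟧ f ρ i) (lookup-⟦⟧ g ρ i) ⟩
  inner (coefficients f) _ xor inner (coefficients g) _ ≡⟨ inner-⊕ (coefficients f) (coefficients g) _ ⟨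
  inner (coefficients (f ⊕ᵉ g)) _                ∎
  where open ≡-Reasoning

⊕-solve : ∀ {k n} (f g : Expr k) → coefficients f ≡ coefficients g → (ρ : Fin k → Vec Bool n) → ⟦ f ⟧ ρ ≡ ⟦ g ⟧ ρ
⊕-solve f g same ρ = lookup-extensional _ _ λ i →
  trans (lookup-⟦⟧ f ρ i) (trans (cong (λ u → inner u _) same) (sym (lookup-⟦⟧ g ρ i)))

⊕-separate : ∀ {k n} (f g : Expr k) (ρ : Fin k → Vec Bool n) (i : Fin n) (σ : Fin k → Bool) →
  (∀ j → lookup (ρ j) i ≡ σ j) → inner (coefficients (f ⊕ᵉ g)) σ ≡ true →
  1 ≤ hamming (⟦ f ⟧ ρ) (⟦ g ⟧ ρ)
⊕-separate f g ρ i σ atI differ = differ⇒hamming≥1 (⟦ f ⟧ ρ) (⟦ g ⟧ ρ) i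
  (trans (lookup-⟦⟧ (f ⊕ᵉ g) ρ i) (trans (inner-cong (coefficients (f ⊕ᵉ g)) atI) differ))

record CodeWalk {m : ℕ} (N : ℕ) (c : ℕ → Vertex m) : Set where
  field
    long     : 6 ≤ N
    step₁    : ∀ p → suc p < N → hamming (c p) (c (suc p)) ≡ 1
    step₂    : ∀ p → suc (suc p) < N → hamming (c p) (c (suc (suc p))) ≡ 2
    spread   : ∀ i d → 3 ≤ d → d + 3 ≤ N → i + d < N → 3 ≤ hamming (c i) (c (i + d))
    -- the same for the pairs that wrap around from position N-1 to 0
    close₁   : ∀ i → suc i ≡ N → hamming (c i) (c 0) ≡ 1
    close₂   : ∀ i → suc (suc i) ≡ N → hamming (c i) (c 0) ≡ 2
    close₂′  : ∀ i → suc i ≡ N → hamming (c i) (c 1) ≡ 2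

-- Agreement of the Hamming distance of u, v with a cyclic distance cd,
-- up to the threshold 3 that matters for (n,3) circuit codes.
data Agree {m} (u v : Vertex m) (cd : ℕ) : Set where
  at1   : cd ≡ 1 → hamming u v ≡ 1 → Agree u v cd
  at2   : cd ≡ 2 → hamming u v ≡ 2 → Agree u v cd
  at≥3  : 3 ≤ cd → 3 ≤ hamming u v → Agree u v cd

Agree-sym : ∀ {m} {u v : Vertex m} {cd} → Agree u v cd → Agree v u cd
Agree-sym {u = u} {v} (at1 cd h) = at1 cd (trans (hamming-sym v u) h)
Agree-sym {u = u} {v} (at2 cd h) = at2 cd (trans (hamming-sym v u) h)
Agree-sym {u = u} {v} (at≥3 cd h) = at≥3 cd (subst (3 ≤_) (hamming-sym u v) h)

module CodeWalkToCode {m N : ℕ} {c : ℕ → Vertex m} (walk : CodeWalk N c) where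
  open CodeWalk walk

  private
    split∸ : ∀ d r → N ∸ d ≡ r → d ≤ N → N ≡ r + d
    split∸ d r eq d≤N = trans (sym (m∸n+n≡m d≤N)) (cong (_+ d) eq)

  -- Forward distance d = N - 1 (only position 0 fits): a closing step.
  agree-wrap₁ : ∀ a d → a + d < N → N ≡ 1 + d → Agree (c a) (c (a + d)) 1
  agree-wrap₁ zero d _ eq = at1 refl (trans (hamming-sym (c 0) (c d)) (close₁ d (sym eq)))
  agree-wrap₁ (suc a) d lt eq = ⊥-elim (<-irrefl refl (≤-trans (s≤s (m≤n+m d a)) (s≤s⁻¹ (subst (suc a + d <_) eq lt))))

  -- Forward distance d = N - 2 (positions 0 and 1 fit): closing pairs.
  agree-wrap₂ : ∀ a d → a + d < N → N ≡ 2 + d → Agree (c a) (c (a + d)) 2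
  agree-wrap₂ zero d _ eq = at2 refl (trans (hamming-sym (c 0) (c d)) (close₂ d (sym eq)))
  agree-wrap₂ (suc zero) d _ eq = at2 refl (trans (hamming-sym (c 1) (c (suc d))) (close₂′ (suc d) (sym eq)))
  agree-wrap₂ (suc (suc a)) d lt eq =
    ⊥-elim (<-irrefl refl (≤-trans (s≤s (m≤n+m d a)) (s≤s⁻¹ (s≤s⁻¹ (subst (suc (suc a) + d <_) eq lt)))))

  agree-forward : ∀ a D → a + suc D < N → Agree (c a) (c (a + suc D)) (suc D ⊓ (N ∸ suc D))
  agree-forward a zero lt = at1 (m≤n⇒m⊓n≡m (m+n≤o⇒m≤o∸n 1 (≤-trans (s≤s (s≤s z≤n)) long)))
    (subst (λ z → hamming (c a) (c z) ≡ 1) (+-comm 1 a) (step₁ a (subst (_< N) (+-comm a 1) lt)))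
  agree-forward a (suc zero) lt = at2 (m≤n⇒m⊓n≡m (m+n≤o⇒m≤o∸n 2 (≤-trans (s≤s (s≤s (s≤s (s≤s z≤n)))) long)))
    (subst (λ z → hamming (c a) (c z) ≡ 2) (+-comm 2 a) (step₂ a (subst (_< N) (+-comm a 2) lt)))
  agree-forward a (suc (suc D)) lt with N ∸ (3 + D) in rest
  ... | zero = ⊥-elim (<-irrefl refl (≤-trans lt (≤-trans (≤-reflexive (split∸ _ 0 rest d≤N)) (m≤n+m _ a))))
    where d≤N = ≤-trans (m≤n+m _ a) (<⇒≤ lt)
  ... | suc zero = agree-wrap₁ a (3 + D) lt (split∸ _ _ rest (≤-trans (m≤n+m _ a) (<⇒≤ lt)))
  ... | suc (suc zero) = agree-wrap₂ a (3 + D) lt (split∸ _ _ rest (≤-trans (m≤n+m _ a) (<⇒≤ lt)))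
  ... | suc (suc (suc r)) = at≥3 (⊓-glb (s≤s (s≤s (s≤s z≤n))) (s≤s (s≤s (s≤s z≤n))))
                                 (spread a (3 + D) (s≤s (s≤s (s≤s z≤n))) room lt)
    where
    room : 3 + D + 3 ≤ N
    room = subst (3 + D + 3 ≤_) (sym (split∸ _ _ rest (≤-trans (m≤n+m _ a) (<⇒≤ lt))))
                 (≤-trans (≤-reflexive (+-comm (3 + D) 3)) (+-monoˡ-≤ (3 + D) (s≤s (s≤s (s≤s z≤n)))))

  agree-ordered : ∀ (i j : Fin N) → toℕ i ≤ toℕ j → i ≡ j ⊎ Agree (c (toℕ i)) (c (toℕ j)) (cycDist i j)
  agree-ordered i j i≤j with toℕ j ∸ toℕ i in gap
  ... | zero = inj₁ (toℕ-injective (sym (trans (sym (m+[n∸m]≡n i≤j)) (trans (cong (toℕ i +_) gap) (+-identityʳ (toℕ i))))))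
  ... | suc D = inj₂ (subst₂ (λ z w → Agree (c (toℕ i)) (c z) w) j≡ cd≡ (agree-forward (toℕ i) D (subst (_< N) (sym j≡) (toℕ<n j))))
    where
    j≡ : toℕ i + suc D ≡ toℕ j
    j≡ = trans (cong (toℕ i +_) (sym gap)) (m+[n∸m]≡n i≤j)
    cd≡ : suc D ⊓ (N ∸ suc D) ≡ cycDist i j
    cd≡ = cong (λ z → z ⊓ (N ∸ z)) (sym (trans (m≤n⇒∣m-n∣≡n∸m i≤j) gap))

  agree : ∀ (i j : Fin N) → i ≡ j ⊎ Agree (c (toℕ i)) (c (toℕ j)) (cycDist i j)
  agree i j with ≤-total (toℕ i) (toℕ j)
  ... | inj₁ i≤j = agree-ordered i j i≤j
  ... | inj₂ j≤i with agree-ordered j i j≤i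
  ...   | inj₁ j≡i = inj₁ (sym j≡i)
  ...   | inj₂ ag = inj₂ (subst (Agree (c (toℕ i)) (c (toℕ j))) (cong (λ z → z ⊓ (N ∸ z)) (∣-∣-comm (toℕ j) (toℕ i))) (Agree-sym ag))

  private
    cycDist-self : ∀ (i : Fin N) → cycDist i i ≡ 0
    cycDist-self i rewrite ∣n-n∣≡0 (toℕ i) = refl

    hamming-≡ : ∀ {u v : Vertex m} → u ≡ v → hamming u v ≡ 0
    hamming-≡ {u} refl = hamming-self u

  codeWalk⇒circuitCode : IsCircuitCode m 3 N (λ i → c (toℕ i))
  codeWalk⇒circuitCode = (≤-trans (s≤s (s≤s (s≤s z≤n))) long , injective , adjacency) , distances
    where
    x : Fin N → Vertex m
    x i = c (toℕ i)

    injective : ∀ {i j} → x i ≡ x j → i ≡ j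
    injective {i} {j} same with agree i j
    ... | inj₁ i≡j = i≡j
    ... | inj₂ (at1 _ h) = ⊥-elim (1+n≢0 (trans (sym h) (hamming-≡ same)))
    ... | inj₂ (at2 _ h) = ⊥-elim (1+n≢0 (trans (sym h) (hamming-≡ same)))
    ... | inj₂ (at≥3 _ h) = ⊥-elim (<⇒≱ (s≤s z≤n) (subst (3 ≤_) (hamming-≡ same) h))

    adjacency : ∀ i j → (Adjacent (x i) (x j) → cycDist i j ≡ 1) × (cycDist i j ≡ 1 → Adjacent (x i) (x j))
    adjacency i j with agree i j
    ... | inj₁ refl = (λ h → ⊥-elim (0≢1+n (trans (sym (hamming-self (x i))) h)))
                    , (λ cd → ⊥-elim (0≢1+n (trans (sym (cycDist-self i)) cd)))
    ... | inj₂ (at1 cd h) = (λ _ → cd) , (λ _ → h)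
    ... | inj₂ (at2 cd h) = (λ a → ⊥-elim (1+n≢n (trans (sym h) a))) , (λ a → ⊥-elim (1+n≢n (trans (sym cd) a)))
    ... | inj₂ (at≥3 cd h) = (λ a → ⊥-elim (<⇒≱ (s≤s (s≤s z≤n)) (subst (3 ≤_) a h)))
                           , (λ a → ⊥-elim (<⇒≱ (s≤s (s≤s z≤n)) (subst (3 ≤_) a cd)))

    distances : ∀ i j → hamming (x i) (x j) < 3 → cycDist i j ≡ hamming (x i) (x j)
    distances i j small with agree i j
    ... | inj₁ refl = trans (cycDist-self i) (sym (hamming-self (x i)))
    ... | inj₂ (at1 cd h) = trans cd (sym h)
    ... | inj₂ (at2 cd h) = trans cd (sym h)
    ... | inj₂ (at≥3 _ h) = ⊥-elim (<⇒≱ small h)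

record Segment {k : ℕ} (N : ℕ) (B : ℕ → Vertex k) : Set where
  field
    step₁  : ∀ q → suc q < N → hamming (B q) (B (suc q)) ≡ 1
    step₂  : ∀ q → suc (suc q) < N → hamming (B q) (B (suc (suc q))) ≡ 2
    spread : ∀ q d → 3 ≤ d → q + d < N → 3 ≤ hamming (B q) (B (q + d))

record Junction {k : ℕ} (N : ℕ) (B B′ : ℕ → Vertex k) : Set where
  field
    step₁  : ∀ q → suc q ≡ N → hamming (B q) (B′ 0) ≡ 1
    step₂  : ∀ q → suc (suc q) ≡ N → hamming (B q) (B′ 0) ≡ 2
    step₂′ : ∀ q → suc q ≡ N → hamming (B q) (B′ 1) ≡ 2
    spread : ∀ q q′ → q < N → q′ < N → q + 3 ≤ N + q′ → 3 ≤ hamming (B q) (B′ q′)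

module Concat {k : ℕ} (N : ℕ) (B₀ B₁ B₂ : ℕ → Vertex k) where

  W : ℕ → Vertex k
  W p with p <? N
  ... | yes _ = B₀ p
  ... | no _ with p ∸ N <? N
  ...   | yes _ = B₁ (p ∸ N)
  ...   | no _ = B₂ (p ∸ N ∸ N)

  W₀ : ∀ q → q < N → W q ≡ B₀ q
  W₀ q q<N with q <? N
  ... | yes _ = refl
  ... | no q≮N = ⊥-elim (q≮N q<N)

  W₁ : ∀ {p} q → q < N → p ≡ N + q → W p ≡ B₁ q
  W₁ q q<N refl with N + q <? N
  ... | yes lt = ⊥-elim (<-irrefl refl (≤-trans lt (m≤m+n N q)))
  ... | no _ with N + q ∸ N <? N
  ...   | yes _ = cong B₁ (m+n∸m≡n N q)
  ...   | no ≮N = ⊥-elim (≮N (subst (_< N) (sym (m+n∸m≡n N q)) q<N))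

  private
    drop-N : ∀ q → N + N + q ∸ N ≡ N + q
    drop-N q = trans (cong (_∸ N) (+-assoc N N q)) (m+n∸m≡n N (N + q))

  W₂ : ∀ {p} q → p ≡ N + N + q → W p ≡ B₂ q
  W₂ q refl with N + N + q <? N
  ... | yes lt = ⊥-elim (<-irrefl refl (≤-trans lt (≤-trans (m≤m+n N N) (m≤m+n (N + N) q))))
  ... | no _ with N + N + q ∸ N <? N
  ...   | yes lt = ⊥-elim (<-irrefl refl (≤-trans lt (subst (N ≤_) (sym (drop-N q)) (m≤m+n N q))))
  ...   | no _ = cong B₂ (trans (cong (_∸ N) (drop-N q)) (m+n∸m≡n N q))

  data Position (p : ℕ) : Set where
    in₀ : p < N → Position p
    in₁ : ∀ q → q < N → p ≡ N + q → Position p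
    in₂ : ∀ q → q < N → p ≡ N + N + q → Position p

  position : ∀ p → p < N + N + N → Position p
  position p p<3N with p <? N
  ... | yes p<N = in₀ p<N
  ... | no p≮N with p ∸ N <? N
  ...   | yes q<N = in₁ (p ∸ N) q<N (sym (m+[n∸m]≡n (≮⇒≥ p≮N)))
  ...   | no q≮N = in₂ (p ∸ N ∸ N) q<N p≡
    where
    p≡ : p ≡ N + N + (p ∸ N ∸ N)
    p≡ = sym (trans (+-assoc N N _) (trans (cong (N +_) (m+[n∸m]≡n (≮⇒≥ q≮N))) (m+[n∸m]≡n (≮⇒≥ p≮N))))
    q<N : p ∸ N ∸ N < N
    q<N = +-cancelˡ-< (N + N) _ _ (subst (_< N + N + N) p≡ p<3N)

  along : ∀ (Rel : Vertex k → Vertex k → Set) {u u′ v v′} → u ≡ u′ → v ≡ v′ → Rel u′ v′ → Rel u v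
  along Rel refl refl r = r

  private
    0<N : ∀ {q} → q < N → 0 < N
    0<N q<N = ≤-<-trans z≤n q<N

    last : ∀ {q} → q < N → ¬ suc q < N → suc q ≡ N
    last q<N ¬q+1<N = ≤-antisym q<N (≮⇒≥ ¬q+1<N)

    N+suc : ∀ {p} a q → p ≡ a + q → suc p ≡ a + suc q
    N+suc {p} a q p≡ = trans (cong suc p≡) (sym (+-suc a q))

  module Offset₁ (Rel : Vertex k → Vertex k → Set)
    (inside₀ : ∀ q → suc q < N → Rel (B₀ q) (B₀ (suc q)))
    (inside₁ : ∀ q → suc q < N → Rel (B₁ q) (B₁ (suc q)))
    (inside₂ : ∀ q → suc q < N → Rel (B₂ q) (B₂ (suc q)))
    (seam₀₁ : ∀ q → suc q ≡ N → Rel (B₀ q) (B₁ 0))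
    (seam₁₂ : ∀ q → suc q ≡ N → Rel (B₁ q) (B₂ 0))
    where

    private
      from₀ : ∀ p → p < N → Dec (suc p < N) → Rel (W p) (W (suc p))
      from₀ p p<N (yes p+1<N) = along Rel (W₀ p p<N) (W₀ (suc p) p+1<N) (inside₀ p p+1<N)
      from₀ p p<N (no p+1≮N) = along Rel (W₀ p p<N) (W₁ 0 (0<N p<N) (trans (last p<N p+1≮N) (sym (+-identityʳ N))))
                                     (seam₀₁ p (last p<N p+1≮N))

      from₁ : ∀ p q → q < N → p ≡ N + q → Dec (suc q < N) → Rel (W p) (W (suc p))
      from₁ p q q<N p≡ (yes q+1<N) = along Rel (W₁ q q<N p≡) (W₁ (suc q) q+1<N (N+suc N q p≡)) (inside₁ q q+1<N)
      from₁ p q q<N p≡ (no q+1≮N) =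
        along Rel (W₁ q q<N p≡) (W₂ 0 (trans (N+suc N q p≡) (trans (cong (N +_) (last q<N q+1≮N)) (sym (+-identityʳ (N + N))))))
              (seam₁₂ q (last q<N q+1≮N))

    offset₁ : ∀ p → suc p < N + N + N → Rel (W p) (W (suc p))
    offset₁ p lt with position p (<-trans (n<1+n p) lt)
    ... | in₀ p<N = from₀ p p<N (suc p <? N)
    ... | in₁ q q<N p≡ = from₁ p q q<N p≡ (suc q <? N)
    ... | in₂ q q<N p≡ = along Rel (W₂ q p≡) (W₂ (suc q) (N+suc (N + N) q p≡)) (inside₂ q q+1<N)
      where
      q+1<N : suc q < N
      q+1<N = +-cancelˡ-< (N + N) _ _ (subst (_< N + N + N) (N+suc (N + N) q p≡) lt)

  -- Positions two apart are related by Rel, up to a limit lim ≤ N inside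
  -- the last segment (the full walk is the case lim = N).
  module Offset₂ (Rel : Vertex k → Vertex k → Set) (lim : ℕ) (lim≤N : lim ≤ N) (1<N : 1 < N)
    (inside₀ : ∀ q → suc (suc q) < N → Rel (B₀ q) (B₀ (suc (suc q))))
    (inside₁ : ∀ q → suc (suc q) < N → Rel (B₁ q) (B₁ (suc (suc q))))
    (inside₂ : ∀ q → suc (suc q) < lim → Rel (B₂ q) (B₂ (suc (suc q))))
    (seam₀₁ : ∀ q → suc (suc q) ≡ N → Rel (B₀ q) (B₁ 0))
    (seam₀₁′ : ∀ q → suc q ≡ N → Rel (B₀ q) (B₁ 1))
    (seam₁₂ : ∀ q → suc (suc q) ≡ N → Rel (B₁ q) (B₂ 0))
    (seam₁₂′ : ∀ q → suc q ≡ N → Rel (B₁ q) (B₂ 1))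
    where

    private
      N+suc² : ∀ {p} a q → p ≡ a + q → suc (suc p) ≡ a + suc (suc q)
      N+suc² a q p≡ = N+suc a (suc q) (N+suc a q p≡)

      p<3N : ∀ p → suc (suc p) < N + N + lim → p < N + N + N
      p<3N p lt = <-≤-trans (≤-trans (n≤1+n _) (≤-trans (n≤1+n _) lt)) (+-monoʳ-≤ (N + N) lim≤N)

    offset₂ : ∀ p → suc (suc p) < N + N + lim → Rel (W p) (W (suc (suc p)))
    offset₂ p lt with position p (p<3N p lt)
    ... | in₀ p<N with <-cmp (suc (suc p)) N
    ...   | tri< p+2<N _ _ = along Rel (W₀ p p<N) (W₀ _ p+2<N) (inside₀ p p+2<N)
    ...   | tri≈ _ p+2≡N _ = along Rel (W₀ p p<N) (W₁ 0 (0<N p<N) (trans p+2≡N (sym (+-identityʳ N)))) (seam₀₁ p p+2≡N)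
    ...   | tri> _ _ N<p+2 = along Rel (W₀ p p<N) (W₁ 1 1<N (trans (cong suc p+1≡N) (+-comm 1 N))) (seam₀₁′ p p+1≡N)
      where
      p+1≡N : suc p ≡ N
      p+1≡N = ≤-antisym p<N (s≤s⁻¹ N<p+2)
    offset₂ p lt | in₁ q q<N p≡ with <-cmp (suc (suc q)) N
    ...   | tri< q+2<N _ _ = along Rel (W₁ q q<N p≡) (W₁ _ q+2<N (N+suc² N q p≡)) (inside₁ q q+2<N)
    ...   | tri≈ _ q+2≡N _ =
      along Rel (W₁ q q<N p≡)
            (W₂ 0 (trans (N+suc² N q p≡) (trans (cong (N +_) q+2≡N) (sym (+-identityʳ (N + N))))))
            (seam₁₂ q q+2≡N)
    ...   | tri> _ _ N<q+2 =
      along Rel (W₁ q q<N p≡)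
            (W₂ 1 (trans (N+suc² N q p≡) (trans (cong (λ z → N + suc z) q+1≡N) (trans (+-suc N N) (+-comm 1 (N + N))))))
            (seam₁₂′ q q+1≡N)
      where
      q+1≡N : suc q ≡ N
      q+1≡N = ≤-antisym q<N (s≤s⁻¹ N<q+2)
    offset₂ p lt | in₂ q q<N p≡ = along Rel (W₂ q p≡) (W₂ (suc (suc q)) (N+suc² (N + N) q p≡)) (inside₂ q q+2<lim)
      where
      q+2<lim : suc (suc q) < lim
      q+2<lim = +-cancelˡ-< (N + N) _ _ (subst (_< N + N + lim) (N+suc² (N + N) q p≡) lt)

  module Assemble (three : 3 ≤ N)
    (S₀ : Segment N B₀) (S₁ : Segment N B₁) (S₂ : Segment N B₂)
    (J₀₁ : Junction N B₀ B₁) (J₁₂ : Junction N B₁ B₂) (J₂₀ : Junction N B₂ B₀)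
    where
    private
      module S₀ = Segment S₀
      module S₁ = Segment S₁
      module S₂ = Segment S₂
      module J₀₁ = Junction J₀₁
      module J₁₂ = Junction J₁₂
      module J₂₀ = Junction J₂₀

      Far : Vertex k → Vertex k → Set
      Far u v = 3 ≤ hamming u v

      behind₁ : ∀ {i d q} → q < N → i ≡ N + q → ¬ i + d < N
      behind₁ {i} {d} {q} _ i≡ lt = <⇒≱ lt (≤-trans (≤-trans (m≤m+n N q) (≤-reflexive (sym i≡))) (m≤m+n i d))

      behind₂ : ∀ {i d q} → i ≡ N + N + q → ¬ i + d < N + N
      behind₂ {i} {d} {q} i≡ lt = <⇒≱ lt (≤-trans (≤-trans (m≤m+n (N + N) q) (≤-reflexive (sym i≡))) (m≤m+n i d))

      within : ∀ {B} → Segment N B → ∀ q d {q′} → 3 ≤ d → q + d ≡ q′ → q′ < N → Far (B q) (B q′)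
      within {B} S q d d≥3 refl q′<N = Segment.spread S q d d≥3 q′<N

      shift : ∀ {i d a q q′} → i ≡ a + q → i + d ≡ a + q′ → q + d ≡ q′
      shift {i} {d} {a} {q} {q′} i≡ j≡ = +-cancelˡ-≡ a _ _ (trans (sym (+-assoc a q d)) (trans (cong (_+ d) (sym i≡)) j≡))

    spread : ∀ i d → 3 ≤ d → d + 3 ≤ N + N + N → i + d < N + N + N → Far (W i) (W (i + d))
    spread i d d≥3 room lt with position i (≤-<-trans (m≤m+n i d) lt) | position (i + d) lt
    ... | in₀ i<N | in₀ j<N = along Far (W₀ i i<N) (W₀ (i + d) j<N) (S₀.spread i d d≥3 j<N)
    ... | in₀ i<N | in₁ q′ q′<N j≡ =
      along Far (W₀ i i<N) (W₁ q′ q′<N j≡) (J₀₁.spread i q′ i<N q′<N (≤-trans (+-monoʳ-≤ i d≥3) (≤-reflexive j≡)))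
    ... | in₀ i<N | in₂ q′ q′<N j≡ =
      along Far (W₀ i i<N) (W₂ q′ j≡) (subst (3 ≤_) (hamming-sym (B₂ q′) (B₀ i)) (J₂₀.spread q′ i q′<N i<N gap))
      where
      gap : q′ + 3 ≤ N + i
      gap = +-cancelˡ-≤ (N + N) _ _ (begin
        N + N + (q′ + 3)  ≡⟨ +-assoc (N + N) q′ 3 ⟨
        N + N + q′ + 3    ≡⟨ cong (_+ 3) j≡ ⟨
        i + d + 3         ≡⟨ +-assoc i d 3 ⟩
        i + (d + 3)       ≤⟨ +-monoʳ-≤ i room ⟩
        i + (N + N + N)   ≡⟨ +-comm i _ ⟩
        N + N + N + i     ≡⟨ +-assoc (N + N) N i ⟩
        N + N + (N + i)   ∎)
        where open ≤-Reasoning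
    ... | in₁ q q<N i≡ | in₀ j<N = ⊥-elim (behind₁ q<N i≡ j<N)
    ... | in₁ q q<N i≡ | in₁ q′ q′<N j≡ =
      along Far (W₁ q q<N i≡) (W₁ q′ q′<N j≡) (within S₁ q d d≥3 (shift i≡ j≡) q′<N)
    ... | in₁ q q<N i≡ | in₂ q′ q′<N j≡ =
      along Far (W₁ q q<N i≡) (W₂ q′ j≡)
            (J₁₂.spread q q′ q<N q′<N (≤-trans (+-monoʳ-≤ q d≥3) (≤-reflexive (shift i≡ (trans j≡ (+-assoc N N q′))))))
    ... | in₂ q q<N i≡ | in₀ j<N = ⊥-elim (behind₂ i≡ (<-≤-trans j<N (m≤m+n N N)))
    ... | in₂ q q<N i≡ | in₁ q′ q′<N j≡ = ⊥-elim (behind₂ i≡ (subst (_< N + N) (sym j≡) (+-monoʳ-< N q′<N)))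
    ... | in₂ q q<N i≡ | in₂ q′ q′<N j≡ =
      along Far (W₂ q i≡) (W₂ q′ j≡) (within S₂ q d d≥3 (shift i≡ j≡) q′<N)

    private
      closing : ∀ i r → i + r ≡ N + N + N → suc zero ≤ r → r ≤ 2 → Σ ℕ λ q → q + r ≡ N × i ≡ N + N + q
      closing i r i+r≡ r≥1 r≤2 = i ∸ (N + N) , q+r≡ , sym (m+[n∸m]≡n 2N≤i)
        where
        2N≤i : N + N ≤ i
        2N≤i = +-cancelʳ-≤ r _ _ (≤-trans (+-monoʳ-≤ (N + N) (≤-trans r≤2 (≤-trans (s≤s (s≤s z≤n)) three))) (≤-reflexive (sym i+r≡)))
        q+r≡ : i ∸ (N + N) + r ≡ N
        q+r≡ = +-cancelˡ-≡ (N + N) _ _ (trans (sym (+-assoc (N + N) _ r)) (trans (cong (_+ r) (m+[n∸m]≡n 2N≤i)) i+r≡))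

      0<N′ : 0 < N
      0<N′ = ≤-trans (s≤s z≤n) three

      1<N′ : 1 < N
      1<N′ = ≤-trans (s≤s (s≤s z≤n)) three

      W0 : W 0 ≡ B₀ 0
      W0 = W₀ 0 0<N′

      W1 : W 1 ≡ B₀ 1
      W1 = W₀ 1 1<N′

    close₁ : ∀ i → suc i ≡ N + N + N → hamming (W i) (W 0) ≡ 1
    close₁ i i+1≡ with closing i 1 (trans (+-comm i 1) i+1≡) ≤-refl (s≤s z≤n)
    ... | q , q+1≡N , i≡ = along (λ u v → hamming u v ≡ 1) (W₂ q i≡) W0 (J₂₀.step₁ q (trans (+-comm 1 q) q+1≡N))

    close₂ : ∀ i → suc (suc i) ≡ N + N + N → hamming (W i) (W 0) ≡ 2
    close₂ i i+2≡ with closing i 2 (trans (+-comm i 2) i+2≡) (s≤s z≤n) ≤-refl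
    ... | q , q+2≡N , i≡ = along (λ u v → hamming u v ≡ 2) (W₂ q i≡) W0 (J₂₀.step₂ q (trans (+-comm 2 q) q+2≡N))

    close₂′ : ∀ i → suc i ≡ N + N + N → hamming (W i) (W 1) ≡ 2
    close₂′ i i+1≡ with closing i 1 (trans (+-comm i 1) i+1≡) ≤-refl (s≤s z≤n)
    ... | q , q+1≡N , i≡ = along (λ u v → hamming u v ≡ 2) (W₂ q i≡) W1 (J₂₀.step₂′ q (trans (+-comm 1 q) q+1≡N))

    codeWalk : CodeWalk (N + N + N) W
    codeWalk = record
      { long    = ≤-trans (+-mono-≤ three three) (m≤m+n (N + N) N)
      ; step₁   = Offset₁.offset₁ (λ u v → hamming u v ≡ 1) S₀.step₁ S₁.step₁ S₂.step₁ J₀₁.step₁ J₁₂.step₁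
      ; step₂   = Offset₂.offset₂ (λ u v → hamming u v ≡ 2) N ≤-refl 1<N′ S₀.step₂ S₁.step₂ S₂.step₂
                                  J₀₁.step₂ J₀₁.step₂′ J₁₂.step₂ J₁₂.step₂′
      ; spread  = spread
      ; close₁  = close₁
      ; close₂  = close₂
      ; close₂′ = close₂′
      }

-- A code walk c of length N = L + 3 is
-- *triplable* when it starts at 0 and ends by flipping three distinct
-- coordinates P, Q, R in turn (c L = P+Q+R, c (L+1) = Q+R, c (L+2) = R),
-- and a few local distance conditions hold: the walk never makes a
-- two-step move by P+Q, Q+R or P+R, and the flips of P, Q, R near the two
-- ends of the walk stay at distance 2 from it.  These local conditions
-- are exactly what is needed to glue three translated copies of the walk
-- into a triplable walk of length 3N in three more dimensions.

data OneOf {m : ℕ} (P Q R : Fin m) : Fin m → Set where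
  isP : OneOf P Q R P
  isQ : OneOf P Q R Q
  isR : OneOf P Q R R

record Triplable (m N : ℕ) (c : ℕ → Vertex m) : Set where
  field
    walk   : CodeWalk N c
    L      : ℕ
    N≡3+L  : N ≡ 3 + L
    L≥5    : 5 ≤ L
    P Q R  : Fin m
    P≢Q    : ¬ P ≡ Q
    Q≢R    : ¬ Q ≡ R
    P≢R    : ¬ P ≡ R
    start  : c 0 ≡ zeros
    end₀   : c L ≡ e P ⊕ (e Q ⊕ e R)
    end₁   : c (suc L) ≡ e Q ⊕ e R
    end₂   : c (suc (suc L)) ≡ e R
    avoidPQ : ∀ q → 2 + q ≤ L → 1 ≤ hamming (c q ⊕ (e P ⊕ e Q)) (c (2 + q))
    avoidQR : ∀ q → 2 + q ≤ L → 1 ≤ hamming (c q ⊕ (e Q ⊕ e R)) (c (2 + q))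
    avoidPR : ∀ q → 2 + q ≤ L → 1 ≤ hamming (c q ⊕ (e P ⊕ e R)) (c (2 + q))
    nearEnd   : ∀ x → OneOf P Q R x → ∀ q → q < L → L ≤ 2 + q → 2 ≤ hamming (c L ⊕ e x) (c q)
    nearStart : ∀ x → OneOf P Q R x → ∀ q → 1 ≤ q → q ≤ 2 → 2 ≤ hamming (e x) (c q)

module TriplableFacts {m N : ℕ} {c : ℕ → Vertex m} (T : Triplable m N c) where
  open Triplable T
  open CodeWalk walk

  below-N : ∀ q → q ≤ 2 + L → q < N
  below-N q le = subst (q <_) (sym N≡3+L) (s≤s le)

  spread′ : ∀ q d → 3 ≤ d → d ≤ L → q + d ≤ 2 + L → 3 ≤ hamming (c q) (c (q + d))
  spread′ q d d≥3 d≤L le = spread q d d≥3 room (below-N _ le)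
    where
    room : d + 3 ≤ N
    room = subst (d + 3 ≤_) (sym N≡3+L) (≤-trans (≤-reflexive (+-comm d 3)) (s≤s (s≤s (s≤s d≤L))))

  gap≥3 : ∀ q q′ → q + 3 ≤ q′ → q′ ≤ L → 3 ≤ hamming (c q) (c q′)
  gap≥3 q q′ le q′≤L = subst (λ z → 3 ≤ hamming (c q) (c z)) q+gap
    (spread′ q (q′ ∸ q) (m+n≤o⇒m≤o∸n 3 (subst (_≤ q′) (+-comm q 3) le)) (≤-trans (m∸n≤m q′ q) q′≤L)
             (≤-trans (≤-reflexive q+gap) (≤-trans q′≤L (m≤n+m L 2))))
    where
    q+gap : q + (q′ ∸ q) ≡ q′
    q+gap = m+[n∸m]≡n (≤-trans (m≤m+n q 3) le)

  gap≥2 : ∀ q q′ → q + 2 ≤ q′ → q′ ≤ L → 2 ≤ hamming (c q) (c q′)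
  gap≥2 q q′ le q′≤L with suc (suc q) ≟ q′
  ... | yes refl = ≤-reflexive (sym (step₂ q (below-N _ (≤-trans q′≤L (m≤n+m L 2)))))
  ... | no ≢ = ≤-trans (n≤1+n 2) (gap≥3 q q′ (subst (_≤ q′) (sym (+-comm q 3)) (≤∧≢⇒< (subst (_≤ q′) (+-comm q 2) le) ≢)) q′≤L)

  gap≥1 : ∀ q q′ → q < q′ → q′ ≤ L → 1 ≤ hamming (c q) (c q′)
  gap≥1 q q′ lt q′≤L with suc q ≟ q′
  ... | yes refl = ≤-reflexive (sym (step₁ q (below-N _ (≤-trans q′≤L (m≤n+m L 2)))))
  ... | no ≢ = ≤-trans (s≤s z≤n) (gap≥2 q q′ (subst (_≤ q′) (sym (+-comm q 2)) (≤∧≢⇒< lt ≢)) q′≤L)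

  -- A weight-2 translate of the main part is disjoint from it, if this
  -- holds locally at two-steps: closer pairs are ruled out by the weight,
  -- farther ones by the triangle inequality and the spread.
  module Avoid (δ : Vertex m) (weight≡2 : weight δ ≡ 2)
    (local : ∀ q → 2 + q ≤ L → 1 ≤ hamming (c q ⊕ δ) (c (2 + q))) where

    private
      shifted : ∀ u → hamming u (u ⊕ δ) ≡ 2
      shifted u = trans (hamming-shift u δ) weight≡2

      forward : ∀ q d → q + d ≤ L → 1 ≤ hamming (c q ⊕ δ) (c (q + d))
      forward q zero _ rewrite +-identityʳ q =
        ≤-trans (s≤s z≤n) (≤-reflexive (sym (trans (hamming-sym (c q ⊕ δ) (c q)) (shifted (c q)))))
      forward q (suc zero) le rewrite +-comm q 1 =
        subst (1 ≤_) (hamming-sym (c (suc q)) (c q ⊕ δ))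
          (hamming-lower (c q) (c (suc q)) (c q ⊕ δ) 1 1 (≤-reflexive (sym (shifted (c q))))
            (≤-reflexive (step₁ q (below-N _ (≤-trans le (m≤n+m L 2))))))
      forward q (suc (suc zero)) le rewrite +-comm q 2 = local q le
      forward q (suc (suc (suc d))) le = hamming-lower (c q) (c q ⊕ δ) (c (q + (3 + d))) 2 1
        (spread′ q (3 + d) (s≤s (s≤s (s≤s z≤n))) (≤-trans (m≤n+m _ q) le) (≤-trans le (m≤n+m L 2)))
        (≤-reflexive (shifted (c q)))

      ordered : ∀ q q′ → q ≤ q′ → q′ ≤ L → 1 ≤ hamming (c q ⊕ δ) (c q′)
      ordered q q′ q≤q′ q′≤L = subst (λ z → 1 ≤ hamming (c q ⊕ δ) (c z)) (m+[n∸m]≡n q≤q′)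
        (forward q (q′ ∸ q) (≤-trans (≤-reflexive (m+[n∸m]≡n q≤q′)) q′≤L))

    avoid : ∀ q q′ → q ≤ L → q′ ≤ L → 1 ≤ hamming (c q ⊕ δ) (c q′)
    avoid q q′ q≤L q′≤L with ≤-total q q′
    ... | inj₁ q≤q′ = ordered q q′ q≤q′ q′≤L
    ... | inj₂ q′≤q = subst (1 ≤_) swap (ordered q′ q q′≤q q≤L)
      where
      swap : hamming (c q′ ⊕ δ) (c q) ≡ hamming (c q ⊕ δ) (c q′)
      swap = trans (hamming-move (c q′) (c q) δ) (hamming-sym (c q′) (c q ⊕ δ))

  avoidPQ-all : ∀ q q′ → q ≤ L → q′ ≤ L → 1 ≤ hamming (c q ⊕ (e P ⊕ e Q)) (c q′)
  avoidPQ-all = Avoid.avoid (e P ⊕ e Q) (weight-e⊕e P Q P≢Q) avoidPQ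

  avoidQR-all : ∀ q q′ → q ≤ L → q′ ≤ L → 1 ≤ hamming (c q ⊕ (e Q ⊕ e R)) (c q′)
  avoidQR-all = Avoid.avoid (e Q ⊕ e R) (weight-e⊕e Q R Q≢R) avoidQR

  avoidPR-all : ∀ q q′ → q ≤ L → q′ ≤ L → 1 ≤ hamming (c q ⊕ (e P ⊕ e R)) (c q′)
  avoidPR-all = Avoid.avoid (e P ⊕ e R) (weight-e⊕e P R P≢R) avoidPR

  nearEnd-all : ∀ x → OneOf P Q R x → ∀ q → q < L → 2 ≤ hamming (c L ⊕ e x) (c q)
  nearEnd-all x x∈ q q<L with L ≤? 2 + q
  ... | yes close = nearEnd x x∈ q q<L close
  ... | no far = hamming-lower (c L) (c L ⊕ e x) (c q) 1 2
    (subst (3 ≤_) (hamming-sym (c q) (c L)) (gap≥3 q L (subst (_≤ L) (+-comm 3 q) (≰⇒> far)) ≤-refl))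
    (≤-reflexive (hamming-flip (c L) x))

  start-flip : ∀ y → hamming (c 0) (e y) ≡ 1
  start-flip y = begin
    hamming (c 0) (e y)          ≡⟨ cong₂ hamming start (sym (⊕-identityˡ (e y))) ⟩
    hamming zeros (zeros ⊕ e y)  ≡⟨ hamming-flip zeros y ⟩
    1                            ∎
    where open ≡-Reasoning

  nearStart-all : ∀ x → OneOf P Q R x → ∀ q → 1 ≤ q → q ≤ L → 2 ≤ hamming (e x) (c q)
  nearStart-all x x∈ q q≥1 q≤L with q ≤? 2
  ... | yes close = nearStart x x∈ q q≥1 close
  ... | no far = hamming-lower (c 0) (e x) (c q) 1 2 (gap≥3 0 q (≰⇒> far) q≤L) (≤-reflexive (start-flip x))

-- From a triplable walk c of length N = L + 3 in
-- dimension m we build a triplable walk of length 3N in dimension m + 3.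
-- It consists of three copies of the main part c 0 … c L, translated by
-- V₀ = 0, V₁ = Q+R, V₂ = P+Q and tagged by a pattern on three new
-- coordinates; each copy is followed by two turning vertices which change
-- the tag and then flip x = P, Q, R respectively, landing next to the start
-- of the following copy.

module Tripling {m N : ℕ} {c : ℕ → Vertex m} (T : Triplable m N c) where
  open Triplable T
  open CodeWalk walk
  open TriplableFacts T

  data Part (q : ℕ) : Set where
    main  : q ≤ L → Part q
    turn₁ : q ≡ suc L → Part q
    turn₂ : q ≡ suc (suc L) → Part q

  part : ∀ q → q < N → Part q
  part q q<N with q ≤? L
  ... | yes q≤L = main q≤L
  ... | no q≰L with q ≟ suc L
  ...   | yes q≡ = turn₁ q≡
  ...   | no q≢ = turn₂ (≤-antisym (s≤s⁻¹ (subst (q <_) N≡3+L q<N)) (≤∧≢⇒< (≰⇒> q≰L) (λ eq → q≢ (sym eq))))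

  before-turns : ∀ q d → 3 ≤ d → q + d < N → q ≤ L
  before-turns q d d≥3 lt = <⇒≤ (+-cancelˡ-< 3 q L (subst (_< 3 + L) (+-comm q 3) (≤-<-trans (+-monoʳ-≤ q d≥3) (subst (q + d <_) N≡3+L lt))))

  unsuc : ∀ q k t → q + suc k ≤ suc t → q + k ≤ t
  unsuc q k t le = s≤s⁻¹ (subst (_≤ suc t) (+-suc q k) le)

  last₁ : ∀ q → suc q ≡ N → q ≡ suc (suc L)
  last₁ q q+1≡ = suc-injective (trans q+1≡ N≡3+L)

  last₂ : ∀ q → suc (suc q) ≡ N → q ≡ suc L
  last₂ q q+2≡ = suc-injective (suc-injective (trans q+2≡ N≡3+L))

  1≤L : 1 ≤ L
  1≤L = ≤-trans (s≤s z≤n) L≥5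

  record Copy : Set where
    field
      tag tag′ : Vec Bool 3
      V        : Vertex m
      x        : Fin m
      x∈       : OneOf P Q R x
      J₁ J₂    : Vertex m
      tag-adj  : hamming tag tag′ ≡ 1
      J₁≡      : J₁ ≡ c L ⊕ V
      J₂≡      : J₂ ≡ (c L ⊕ e x) ⊕ V

  module CopyWalk (b : Copy) where
    open Copy b

    B : ℕ → Vertex (3 + m)
    B q with q ≤? L
    ... | yes _ = tag ++ (c q ⊕ V)
    ... | no _ with q ≟ suc L
    ...   | yes _ = tag′ ++ J₁
    ...   | no _ = tag′ ++ J₂

    B-main : ∀ q → q ≤ L → B q ≡ tag ++ (c q ⊕ V)
    B-main q q≤L with q ≤? L
    ... | yes _ = refl
    ... | no q≰L = ⊥-elim (q≰L q≤L)

    B-turn₁ : ∀ {p} → p ≡ suc L → B p ≡ tag′ ++ J₁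
    B-turn₁ refl with suc L ≤? L
    ... | yes lt = ⊥-elim (<-irrefl refl lt)
    ... | no _ with suc L ≟ suc L
    ...   | yes _ = refl
    ...   | no ≢ = ⊥-elim (≢ refl)

    B-turn₂ : ∀ {p} → p ≡ suc (suc L) → B p ≡ tag′ ++ J₂
    B-turn₂ refl with suc (suc L) ≤? L
    ... | yes lt = ⊥-elim (<-irrefl refl (≤-trans (n≤1+n (suc L)) lt))
    ... | no _ with suc (suc L) ≟ suc L
    ...   | yes eq = ⊥-elim (<-irrefl (sym eq) ≤-refl)
    ...   | no _ = refl

    dist-main : ∀ q q′ → q ≤ L → q′ ≤ L → hamming (B q) (B q′) ≡ hamming (c q) (c q′)
    dist-main q q′ q≤L q′≤L = begin
      hamming (B q) (B q′)                                ≡⟨ cong₂ hamming (B-main q q≤L) (B-main q′ q′≤L) ⟩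
      hamming (tag ++ (c q ⊕ V)) (tag ++ (c q′ ⊕ V))      ≡⟨ hamming-++ tag tag _ _ ⟩
      hamming tag tag + hamming (c q ⊕ V) (c q′ ⊕ V)      ≡⟨ cong₂ _+_ (hamming-self tag) (hamming-translate (c q) (c q′) V) ⟩
      hamming (c q) (c q′)                                ∎
      where open ≡-Reasoning

    dist-turn₁ : ∀ q p → q ≤ L → p ≡ suc L → hamming (B q) (B p) ≡ 1 + hamming (c q) (c L)
    dist-turn₁ q p q≤L p≡ = begin
      hamming (B q) (B p)                          ≡⟨ cong₂ hamming (B-main q q≤L) (B-turn₁ p≡) ⟩
      hamming (tag ++ (c q ⊕ V)) (tag′ ++ J₁)      ≡⟨ hamming-++ tag tag′ _ _ ⟩
      hamming tag tag′ + hamming (c q ⊕ V) J₁      ≡⟨ cong₂ _+_ tag-adj (cong (hamming (c q ⊕ V)) J₁≡) ⟩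
      1 + hamming (c q ⊕ V) (c L ⊕ V)              ≡⟨ cong suc (hamming-translate (c q) (c L) V) ⟩
      1 + hamming (c q) (c L)                      ∎
      where open ≡-Reasoning

    dist-turn₂ : ∀ q p → q ≤ L → p ≡ suc (suc L) → hamming (B q) (B p) ≡ 1 + hamming (c q) (c L ⊕ e x)
    dist-turn₂ q p q≤L p≡ = begin
      hamming (B q) (B p)                          ≡⟨ cong₂ hamming (B-main q q≤L) (B-turn₂ p≡) ⟩
      hamming (tag ++ (c q ⊕ V)) (tag′ ++ J₂)      ≡⟨ hamming-++ tag tag′ _ _ ⟩
      hamming tag tag′ + hamming (c q ⊕ V) J₂      ≡⟨ cong₂ _+_ tag-adj (cong (hamming (c q ⊕ V)) J₂≡) ⟩
      1 + hamming (c q ⊕ V) ((c L ⊕ e x) ⊕ V)      ≡⟨ cong suc (hamming-translate (c q) (c L ⊕ e x) V) ⟩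
      1 + hamming (c q) (c L ⊕ e x)                ∎
      where open ≡-Reasoning

    dist-turns : ∀ p p′ → p ≡ suc L → p′ ≡ suc (suc L) → hamming (B p) (B p′) ≡ 1
    dist-turns p p′ p≡ p′≡ = begin
      hamming (B p) (B p′)                          ≡⟨ cong₂ hamming (B-turn₁ p≡) (B-turn₂ p′≡) ⟩
      hamming (tag′ ++ J₁) (tag′ ++ J₂)            ≡⟨ hamming-++ tag′ tag′ J₁ J₂ ⟩
      hamming tag′ tag′ + hamming J₁ J₂            ≡⟨ cong₂ _+_ (hamming-self tag′) (cong₂ hamming J₁≡ J₂≡) ⟩
      hamming (c L ⊕ V) ((c L ⊕ e x) ⊕ V)          ≡⟨ hamming-translate (c L) (c L ⊕ e x) V ⟩
      hamming (c L) (c L ⊕ e x)                    ≡⟨ hamming-flip (c L) x ⟩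
      1                                            ∎
      where open ≡-Reasoning

    segment : Segment N B
    segment = record { step₁ = step₁′ ; step₂ = step₂′ ; spread = spread″ }
      where
      step₁′ : ∀ q → suc q < N → hamming (B q) (B (suc q)) ≡ 1
      step₁′ q lt with part (suc q) lt
      ... | main q+1≤L = trans (dist-main q (suc q) (≤-trans (n≤1+n q) q+1≤L) q+1≤L) (step₁ q lt)
      ... | turn₁ q+1≡ = trans (dist-turn₁ q (suc q) (≤-reflexive (suc-injective q+1≡)) q+1≡)
                               (cong suc (trans (cong (λ z → hamming (c q) (c z)) (sym (suc-injective q+1≡))) (hamming-self (c q))))
      ... | turn₂ q+1≡ = dist-turns q (suc q) (suc-injective q+1≡) q+1≡

      step₂′ : ∀ q → suc (suc q) < N → hamming (B q) (B (suc (suc q))) ≡ 2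
      step₂′ q lt with part (suc (suc q)) lt
      ... | main q+2≤L = trans (dist-main q _ (≤-trans (n≤1+n q) (≤-trans (n≤1+n (suc q)) q+2≤L)) q+2≤L) (step₂ q lt)
      ... | turn₁ q+2≡ = trans (dist-turn₁ q (suc (suc q)) (≤-trans (n≤1+n q) (s≤s⁻¹ (≤-reflexive q+2≡))) q+2≡)
                               (cong suc (trans (cong (λ z → hamming (c q) (c z)) (sym (suc-injective q+2≡))) (step₁ q (<-trans (n<1+n (suc q)) lt))))
      ... | turn₂ q+2≡ = trans (dist-turn₂ q (suc (suc q)) (≤-reflexive q≡L) q+2≡)
                               (cong suc (trans (cong (λ z → hamming (c z) (c L ⊕ e x)) q≡L) (hamming-flip (c L) x)))
        where
        q≡L : q ≡ L
        q≡L = suc-injective (suc-injective q+2≡)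

      spread″ : ∀ q d → 3 ≤ d → q + d < N → 3 ≤ hamming (B q) (B (q + d))
      spread″ q d d≥3 lt with part (q + d) lt
      ... | main j≤L = subst (3 ≤_) (sym (dist-main q (q + d) q≤L j≤L)) (gap≥3 q (q + d) (+-monoʳ-≤ q d≥3) j≤L)
        where q≤L = before-turns q d d≥3 lt
      ... | turn₁ j≡ = subst (3 ≤_) (sym (dist-turn₁ q (q + d) q≤L j≡)) (s≤s (gap≥2 q L q+2≤L ≤-refl))
        where
        q≤L = before-turns q d d≥3 lt
        q+2≤L : q + 2 ≤ L
        q+2≤L = unsuc q 2 L (subst (q + 3 ≤_) j≡ (+-monoʳ-≤ q d≥3))
      ... | turn₂ j≡ = subst (3 ≤_) (sym (dist-turn₂ q (q + d) q≤L j≡))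
                              (s≤s (subst (2 ≤_) (hamming-sym (c L ⊕ e x) (c q)) (nearEnd-all x x∈ q q<L)))
        where
        q≤L = before-turns q d d≥3 lt
        q<L : q < L
        q<L = subst (_≤ L) (+-comm q 1) (unsuc q 1 L (unsuc q 2 (suc L) (subst (q + 3 ≤_) j≡ (+-monoʳ-≤ q d≥3))))

  -- When copy b′ follows copy b: the tag patterns are placed so that every
  -- cross pair is far apart on the new coordinates, except main/main
  -- (distance 2, completed by disjointness of the two translates) and
  -- turn/main (distance 1, completed by nearStart and the spread); the
  -- second turn of b is the start of b′ with the tag of b's turns.
  record Follows (b b′ : Copy) : Set where
    private
      module b = Copy b
      module b′ = Copy b′
    field
      tags-main-main : hamming b.tag b′.tag ≡ 2
      tags-main-turn : hamming b.tag b′.tag′ ≡ 3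
      tags-turn-main : hamming b.tag′ b′.tag ≡ 1
      tags-turn-turn : hamming b.tag′ b′.tag′ ≡ 2
      disjoint : ∀ q q′ → q ≤ L → q′ ≤ L → 1 ≤ hamming (c q ⊕ b.V) (c q′ ⊕ b′.V)
      J₁-next  : b.J₁ ≡ e b.x ⊕ b′.V
      J₂-next  : b.J₂ ≡ b′.V
      J₁≢J₁′   : 1 ≤ hamming b.J₁ b′.J₁
      J₁≢J₂′   : 1 ≤ hamming b.J₁ b′.J₂
      J₂≢J₁′   : 1 ≤ hamming b.J₂ b′.J₁
      J₂≢J₂′   : 1 ≤ hamming b.J₂ b′.J₂

  module Seam (b b′ : Copy) (follows : Follows b b′) where
    open Follows follows
    open Copy b
    open Copy b′ using () renaming (tag to tag₊; tag′ to tag₊′; V to V₊; J₁ to J₁₊; J₂ to J₂₊)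
    open CopyWalk b using (B; B-main; B-turn₁; B-turn₂)
    open CopyWalk b′ using () renaming (B to B₊; B-main to B₊-main; B-turn₁ to B₊-turn₁; B-turn₂ to B₊-turn₂)

    private
      tagged : ∀ {u v : Vertex (3 + m)} {u′ v′ : Vertex m} (t t′ : Vec Bool 3) k →
        hamming t t′ ≡ k → u ≡ t ++ u′ → v ≡ t′ ++ v′ → hamming u v ≡ k + hamming u′ v′
      tagged t t′ k tags refl refl = trans (hamming-++ t t′ _ _) (cong (_+ _) tags)

      J₁-to-main : ∀ q′ → hamming J₁ (c q′ ⊕ V₊) ≡ hamming (e x) (c q′)
      J₁-to-main q′ = trans (cong (λ z → hamming z (c q′ ⊕ V₊)) J₁-next) (hamming-translate (e x) (c q′) V₊)

      J₂-to-main : ∀ q′ → hamming J₂ (c q′ ⊕ V₊) ≡ hamming (c 0) (c q′)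
      J₂-to-main q′ = begin
        hamming J₂ (c q′ ⊕ V₊)             ≡⟨ cong (λ z → hamming z (c q′ ⊕ V₊)) (trans J₂-next (sym (⊕-identityˡ V₊))) ⟩
        hamming (zeros ⊕ V₊) (c q′ ⊕ V₊)   ≡⟨ hamming-translate zeros (c q′) V₊ ⟩
        hamming zeros (c q′)               ≡⟨ cong (λ z → hamming z (c q′)) start ⟨
        hamming (c 0) (c q′)               ∎
        where open ≡-Reasoning

      reach : ∀ k q q′ → q ≡ L + k → q + 3 ≤ N + q′ → k ≤ q′
      reach k q q′ q≡ le = +-cancelˡ-≤ (3 + L) k q′ (subst₂ _≤_ lhs (cong (_+ q′) N≡3+L) le)
        where
        lhs : q + 3 ≡ 3 + L + k
        lhs = trans (cong (_+ 3) q≡) (trans (+-comm (L + k) 3) (sym (+-assoc 3 L k)))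

    spread-across : ∀ q q′ → q < N → q′ < N → q + 3 ≤ N + q′ → 3 ≤ hamming (B q) (B₊ q′)
    spread-across q q′ q<N q′<N le with part q q<N | part q′ q′<N
    ... | main q≤L | main q′≤L =
      subst (3 ≤_) (sym (tagged tag tag₊ 2 tags-main-main (B-main q q≤L) (B₊-main q′ q′≤L))) (+-monoʳ-≤ 2 (disjoint q q′ q≤L q′≤L))
    ... | main q≤L | turn₁ q′≡ =
      subst (3 ≤_) (sym (tagged tag tag₊′ 3 tags-main-turn (B-main q q≤L) (B₊-turn₁ q′≡))) (m≤m+n 3 _)
    ... | main q≤L | turn₂ q′≡ =
      subst (3 ≤_) (sym (tagged tag tag₊′ 3 tags-main-turn (B-main q q≤L) (B₊-turn₂ q′≡))) (m≤m+n 3 _)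
    ... | turn₁ q≡ | main q′≤L =
      subst (3 ≤_) (sym (trans (tagged tag′ tag₊ 1 tags-turn-main (B-turn₁ q≡) (B₊-main q′ q′≤L)) (cong suc (J₁-to-main q′))))
        (s≤s (nearStart-all x x∈ q′ (reach 1 q q′ (trans q≡ (+-comm 1 L)) le) q′≤L))
    ... | turn₁ q≡ | turn₁ q′≡ =
      subst (3 ≤_) (sym (tagged tag′ tag₊′ 2 tags-turn-turn (B-turn₁ q≡) (B₊-turn₁ q′≡))) (+-monoʳ-≤ 2 J₁≢J₁′)
    ... | turn₁ q≡ | turn₂ q′≡ =
      subst (3 ≤_) (sym (tagged tag′ tag₊′ 2 tags-turn-turn (B-turn₁ q≡) (B₊-turn₂ q′≡))) (+-monoʳ-≤ 2 J₁≢J₂′)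
    ... | turn₂ q≡ | main q′≤L =
      subst (3 ≤_) (sym (trans (tagged tag′ tag₊ 1 tags-turn-main (B-turn₂ q≡) (B₊-main q′ q′≤L)) (cong suc (J₂-to-main q′))))
        (s≤s (gap≥2 0 q′ (reach 2 q q′ (trans q≡ (+-comm 2 L)) le) q′≤L))
    ... | turn₂ q≡ | turn₁ q′≡ =
      subst (3 ≤_) (sym (tagged tag′ tag₊′ 2 tags-turn-turn (B-turn₂ q≡) (B₊-turn₁ q′≡))) (+-monoʳ-≤ 2 J₂≢J₁′)
    ... | turn₂ q≡ | turn₂ q′≡ =
      subst (3 ≤_) (sym (tagged tag′ tag₊′ 2 tags-turn-turn (B-turn₂ q≡) (B₊-turn₂ q′≡))) (+-monoʳ-≤ 2 J₂≢J₂′)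

    junction : Junction N B B₊
    junction = record
      { step₁ = λ q q+1≡ → trans (tagged tag′ tag₊ 1 tags-turn-main (B-turn₂ (last₁ q q+1≡)) (B₊-main 0 z≤n))
                                 (cong suc (trans (J₂-to-main 0) (hamming-self (c 0))))
      ; step₂ = λ q q+2≡ → trans (tagged tag′ tag₊ 1 tags-turn-main (B-turn₁ (last₂ q q+2≡)) (B₊-main 0 z≤n))
                                 (cong suc (trans (J₁-to-main 0) (trans (hamming-sym (e x) (c 0)) (start-flip x))))
      ; step₂′ = λ q q+1≡ → trans (tagged tag′ tag₊ 1 tags-turn-main (B-turn₂ (last₁ q q+1≡)) (B₊-main 1 1≤L))
                                  (cong suc (trans (J₂-to-main 1) (step₁ 0 (below-N 1 (s≤s z≤n)))))
      ; spread = spread-across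
      }

  private
    gens : Fin 3 → Vertex m
    gens = lookup (e P ∷ e Q ∷ e R ∷ [])

    𝑃 𝑄 𝑅 : Expr 3
    𝑃 = var zero
    𝑄 = var (suc zero)
    𝑅 = var (suc (suc zero))

    atP : ∀ j → lookup (gens j) P ≡ lookup (true ∷ false ∷ false ∷ []) j
    atP zero = lookup-e-same P
    atP (suc zero) = lookup-e-other P Q P≢Q
    atP (suc (suc zero)) = lookup-e-other P R P≢R

    atQ : ∀ j → lookup (gens j) Q ≡ lookup (false ∷ true ∷ false ∷ []) j
    atQ zero = lookup-e-other Q P (λ eq → P≢Q (sym eq))
    atQ (suc zero) = lookup-e-same Q
    atQ (suc (suc zero)) = lookup-e-other Q R Q≢R

    atR : ∀ j → lookup (gens j) R ≡ lookup (false ∷ false ∷ true ∷ []) j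
    atR zero = lookup-e-other R P (λ eq → P≢R (sym eq))
    atR (suc zero) = lookup-e-other R Q (λ eq → Q≢R (sym eq))
    atR (suc (suc zero)) = lookup-e-same R

    differ-P differ-Q differ-R : ∀ (f g : Expr 3) → _ ≡ true → 1 ≤ hamming (⟦ f ⟧ gens) (⟦ g ⟧ gens)
    differ-P f g = ⊕-separate f g gens P _ atP
    differ-Q f g = ⊕-separate f g gens Q _ atQ
    differ-R f g = ⊕-separate f g gens R _ atR

    solve : ∀ (f g : Expr 3) → coefficients f ≡ coefficients g → ⟦ f ⟧ gens ≡ ⟦ g ⟧ gens
    solve f g same = ⊕-solve f g same gens

  ePQR eQR ePQ : Vertex m
  ePQR = e P ⊕ (e Q ⊕ e R)
  eQR = e Q ⊕ e R
  ePQ = e P ⊕ e Q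

  private
    𝑃𝑄𝑅 𝑄𝑅 𝑃𝑄 : Expr 3
    𝑃𝑄𝑅 = 𝑃 ⊕ᵉ (𝑄 ⊕ᵉ 𝑅)
    𝑄𝑅 = 𝑄 ⊕ᵉ 𝑅
    𝑃𝑄 = 𝑃 ⊕ᵉ 𝑄

    at-end : ∀ (G : Vertex m → Vertex m) {y} → y ≡ G ePQR → y ≡ G (c L)
    at-end G y≡ = trans y≡ (cong G (sym end₀))

    translates-disjoint : ∀ (V V′ δ : Vertex m) → V ⊕ V′ ≡ δ →
      (∀ q q′ → q ≤ L → q′ ≤ L → 1 ≤ hamming (c q ⊕ δ) (c q′)) →
      ∀ q q′ → q ≤ L → q′ ≤ L → 1 ≤ hamming (c q ⊕ V) (c q′ ⊕ V′)
    translates-disjoint V V′ δ V⊕V′≡ avoid q q′ q≤L q′≤L = subst (1 ≤_) moved (avoid q q′ q≤L q′≤L)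
      where
      moved : hamming (c q ⊕ δ) (c q′) ≡ hamming (c q ⊕ V) (c q′ ⊕ V′)
      moved = trans (cong (λ z → hamming z (c q′)) (trans (cong (c q ⊕_) (sym V⊕V′≡)) (sym (⊕-assoc (c q) V V′))))
                    (hamming-move (c q ⊕ V) (c q′) V′)

  t000 t100 t110 t111 t011 t001 : Vec Bool 3
  t000 = false ∷ false ∷ false ∷ []
  t100 = true ∷ false ∷ false ∷ []
  t110 = true ∷ true ∷ false ∷ []
  t111 = true ∷ true ∷ true ∷ []
  t011 = false ∷ true ∷ true ∷ []
  t001 = false ∷ false ∷ true ∷ []

  copy₀ copy₁ copy₂ : Copy
  copy₀ = record
    { tag = t000 ; tag′ = t100 ; V = zeros ; x = P ; x∈ = isP ; J₁ = ePQR ; J₂ = eQR ; tag-adj = refl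
    ; J₁≡ = at-end (_⊕ zeros) (sym (⊕-identityʳ ePQR))
    ; J₂≡ = at-end (λ z → (z ⊕ e P) ⊕ zeros) (solve 𝑄𝑅 ((𝑃𝑄𝑅 ⊕ᵉ 𝑃) ⊕ᵉ ∅) refl) }
  copy₁ = record
    { tag = t110 ; tag′ = t111 ; V = eQR ; x = Q ; x∈ = isQ ; J₁ = e P ; J₂ = ePQ ; tag-adj = refl
    ; J₁≡ = at-end (_⊕ eQR) (solve 𝑃 (𝑃𝑄𝑅 ⊕ᵉ 𝑄𝑅) refl)
    ; J₂≡ = at-end (λ z → (z ⊕ e Q) ⊕ eQR) (solve 𝑃𝑄 ((𝑃𝑄𝑅 ⊕ᵉ 𝑄) ⊕ᵉ 𝑄𝑅) refl) }
  copy₂ = record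
    { tag = t011 ; tag′ = t001 ; V = ePQ ; x = R ; x∈ = isR ; J₁ = e R ; J₂ = zeros ; tag-adj = refl
    ; J₁≡ = at-end (_⊕ ePQ) (solve 𝑅 (𝑃𝑄𝑅 ⊕ᵉ 𝑃𝑄) refl)
    ; J₂≡ = at-end (λ z → (z ⊕ e R) ⊕ ePQ) (solve ∅ ((𝑃𝑄𝑅 ⊕ᵉ 𝑅) ⊕ᵉ 𝑃𝑄) refl) }

  follows₀₁ : Follows copy₀ copy₁
  follows₀₁ = record
    { tags-main-main = refl ; tags-main-turn = refl ; tags-turn-main = refl ; tags-turn-turn = refl
    ; disjoint = translates-disjoint zeros eQR eQR (⊕-identityˡ eQR) avoidQR-all
    ; J₁-next = refl ; J₂-next = refl
    ; J₁≢J₁′ = differ-Q 𝑃𝑄𝑅 𝑃 refl ; J₁≢J₂′ = differ-R 𝑃𝑄𝑅 𝑃𝑄 refl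
    ; J₂≢J₁′ = differ-P 𝑄𝑅 𝑃 refl ; J₂≢J₂′ = differ-P 𝑄𝑅 𝑃𝑄 refl }

  follows₁₂ : Follows copy₁ copy₂
  follows₁₂ = record
    { tags-main-main = refl ; tags-main-turn = refl ; tags-turn-main = refl ; tags-turn-turn = refl
    ; disjoint = translates-disjoint eQR ePQ (e P ⊕ e R) (solve (𝑄𝑅 ⊕ᵉ 𝑃𝑄) (𝑃 ⊕ᵉ 𝑅) refl) avoidPR-all
    ; J₁-next = solve 𝑃 (𝑄 ⊕ᵉ 𝑃𝑄) refl ; J₂-next = refl
    ; J₁≢J₁′ = differ-P 𝑃 𝑅 refl ; J₁≢J₂′ = differ-P 𝑃 ∅ refl
    ; J₂≢J₁′ = differ-P 𝑃𝑄 𝑅 refl ; J₂≢J₂′ = differ-P 𝑃𝑄 ∅ refl }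

  follows₂₀ : Follows copy₂ copy₀
  follows₂₀ = record
    { tags-main-main = refl ; tags-main-turn = refl ; tags-turn-main = refl ; tags-turn-turn = refl
    ; disjoint = translates-disjoint ePQ zeros ePQ (⊕-identityʳ ePQ) avoidPQ-all
    ; J₁-next = sym (⊕-identityʳ (e R)) ; J₂-next = refl
    ; J₁≢J₁′ = differ-P 𝑅 𝑃𝑄𝑅 refl ; J₁≢J₂′ = differ-Q 𝑅 𝑄𝑅 refl
    ; J₂≢J₁′ = differ-P ∅ 𝑃𝑄𝑅 refl ; J₂≢J₂′ = differ-Q ∅ 𝑄𝑅 refl }

  B₀ B₁ B₂ : ℕ → Vertex (3 + m)
  B₀ = CopyWalk.B copy₀
  B₁ = CopyWalk.B copy₁
  B₂ = CopyWalk.B copy₂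

  private
    module C₀ = CopyWalk copy₀
    module C₁ = CopyWalk copy₁
    module C₂ = CopyWalk copy₂

  open Concat N B₀ B₁ B₂ using (W₀; W₂; along; module Offset₂; module Assemble)
  open Concat N B₀ B₁ B₂ public using (W)

  N≥3 : 3 ≤ N
  N≥3 = subst (3 ≤_) (sym N≡3+L) (s≤s (s≤s (s≤s z≤n)))

  tripled-walk : CodeWalk (N + N + N) W
  tripled-walk = Assemble.codeWalk N≥3 C₀.segment C₁.segment C₂.segment
    (Seam.junction copy₀ copy₁ follows₀₁) (Seam.junction copy₁ copy₂ follows₁₂) (Seam.junction copy₂ copy₀ follows₂₀)

  -- Its end: the new coordinates P′, R′ are tag coordinates 1 and 2, and
  -- Q′ is the old coordinate R.
  P′ Q′ R′ : Fin (3 + m)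
  P′ = suc zero
  Q′ = suc (suc (suc R))
  R′ = suc (suc zero)

  L′ : ℕ
  L′ = N + N + L

  3N≡3+L′ : N + N + N ≡ 3 + L′
  3N≡3+L′ = begin
    N + N + N        ≡⟨ cong (N + N +_) N≡3+L ⟩
    N + N + (3 + L)  ≡⟨ +-assoc (N + N) 3 L ⟨
    N + N + 3 + L    ≡⟨ cong (_+ L) (+-comm (N + N) 3) ⟩
    3 + (N + N) + L  ≡⟨ +-assoc 3 (N + N) L ⟩
    3 + L′           ∎
    where open ≡-Reasoning

  -- Every δ k has a nonzero
  -- tag part, so inside a copy the condition is immediate; only four seam
  -- cases need the old invariant.
  δ : Fin 3 → Vertex (3 + m)
  δ zero = e P′ ⊕ e Q′
  δ (suc zero) = e Q′ ⊕ e R′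
  δ (suc (suc zero)) = e P′ ⊕ e R′

  Avoids : Fin 3 → Vertex (3 + m) → Vertex (3 + m) → Set
  Avoids k u v = 1 ≤ hamming (u ⊕ δ k) v

  private
    main-before : ∀ {q p} → suc (suc q) ≡ p → p ≤ suc (suc L) → q ≤ L
    main-before refl le = s≤s⁻¹ (s≤s⁻¹ le)

  avoid-in₀ : ∀ k q → suc (suc q) < N → Avoids k (B₀ q) (B₀ (suc (suc q)))
  avoid-in₀ k q lt with part (suc (suc q)) lt
  ... | main q+2≤L = along (Avoids k) (C₀.B-main q q≤L) (C₀.B-main _ q+2≤L) (tags k)
    where
    q≤L = ≤-trans (n≤1+n q) (≤-trans (n≤1+n (suc q)) q+2≤L)
    tags : ∀ k → Avoids k (t000 ++ (c q ⊕ zeros)) (t000 ++ (c (suc (suc q)) ⊕ zeros))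
    tags zero = s≤s z≤n
    tags (suc zero) = s≤s z≤n
    tags (suc (suc zero)) = s≤s z≤n
  ... | turn₁ q+2≡ = along (Avoids k) (C₀.B-main q (main-before q+2≡ (n≤1+n _))) (C₀.B-turn₁ q+2≡) (tags k)
    where
    tags : ∀ k → Avoids k (t000 ++ (c q ⊕ zeros)) (t100 ++ ePQR)
    tags zero = s≤s z≤n
    tags (suc zero) = s≤s z≤n
    tags (suc (suc zero)) = s≤s z≤n
  ... | turn₂ q+2≡ = along (Avoids k) (C₀.B-main q (main-before q+2≡ ≤-refl)) (C₀.B-turn₂ q+2≡) (tags k)
    where
    tags : ∀ k → Avoids k (t000 ++ (c q ⊕ zeros)) (t100 ++ eQR)
    tags zero = s≤s z≤n
    tags (suc zero) = s≤s z≤n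
    tags (suc (suc zero)) = s≤s z≤n

  -- Seam cases inside copy 1, where the tag of δ 1 is the tag change.
  private
    before-turn₁ : ∀ q → suc q ≡ L → 1 ≤ hamming ((c q ⊕ eQR) ⊕ (e R ⊕ zeros)) (e P)
    before-turn₁ q q+1≡L = ≤-trans (s≤s z≤n) (subst (2 ≤_) moved
      (nearEnd R isR q (subst (q <_) q+1≡L ≤-refl) (≤-trans (≤-reflexive (sym q+1≡L)) (n≤1+n (suc q)))))
      where
      collapse : e P ⊕ (eQR ⊕ (e R ⊕ zeros)) ≡ c L ⊕ e R
      collapse = at-end (_⊕ e R) (solve (𝑃 ⊕ᵉ (𝑄𝑅 ⊕ᵉ (𝑅 ⊕ᵉ ∅))) (𝑃𝑄𝑅 ⊕ᵉ 𝑅) refl)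
      moved : hamming (c L ⊕ e R) (c q) ≡ hamming ((c q ⊕ eQR) ⊕ (e R ⊕ zeros)) (e P)
      moved = begin
        hamming (c L ⊕ e R) (c q)                            ≡⟨ hamming-sym (c L ⊕ e R) (c q) ⟩
        hamming (c q) (c L ⊕ e R)                            ≡⟨ cong (hamming (c q)) collapse ⟨
        hamming (c q) (e P ⊕ (eQR ⊕ (e R ⊕ zeros)))          ≡⟨ hamming-move (c q) (e P) (eQR ⊕ (e R ⊕ zeros)) ⟨
        hamming (c q ⊕ (eQR ⊕ (e R ⊕ zeros))) (e P)          ≡⟨ cong (λ z → hamming z (e P)) (⊕-assoc (c q) eQR (e R ⊕ zeros)) ⟨
        hamming ((c q ⊕ eQR) ⊕ (e R ⊕ zeros)) (e P)          ∎
        where open ≡-Reasoning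

    at-turn₁ : 1 ≤ hamming ((c L ⊕ eQR) ⊕ (e R ⊕ zeros)) ePQ
    at-turn₁ rewrite end₀ = differ-Q ((𝑃𝑄𝑅 ⊕ᵉ 𝑄𝑅) ⊕ᵉ (𝑅 ⊕ᵉ ∅)) 𝑃𝑄 refl

  avoid-in₁ : ∀ k q → suc (suc q) < N → Avoids k (B₁ q) (B₁ (suc (suc q)))
  avoid-in₁ k q lt with part (suc (suc q)) lt
  ... | main q+2≤L = along (Avoids k) (C₁.B-main q q≤L) (C₁.B-main _ q+2≤L) (tags k)
    where
    q≤L = ≤-trans (n≤1+n q) (≤-trans (n≤1+n (suc q)) q+2≤L)
    tags : ∀ k → Avoids k (t110 ++ (c q ⊕ eQR)) (t110 ++ (c (suc (suc q)) ⊕ eQR))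
    tags zero = s≤s z≤n
    tags (suc zero) = s≤s z≤n
    tags (suc (suc zero)) = s≤s z≤n
  ... | turn₁ q+2≡ = along (Avoids k) (C₁.B-main q (main-before q+2≡ (n≤1+n _))) (C₁.B-turn₁ q+2≡) (tags k)
    where
    tags : ∀ k → Avoids k (t110 ++ (c q ⊕ eQR)) (t111 ++ e P)
    tags zero = s≤s z≤n
    tags (suc zero) = before-turn₁ q (suc-injective q+2≡)
    tags (suc (suc zero)) = s≤s z≤n
  ... | turn₂ q+2≡ = along (Avoids k) (C₁.B-main q (main-before q+2≡ ≤-refl)) (C₁.B-turn₂ q+2≡) (tags k)
    where
    q≡L : q ≡ L
    q≡L = suc-injective (suc-injective q+2≡)
    tags : ∀ k → Avoids k (t110 ++ (c q ⊕ eQR)) (t111 ++ ePQ)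
    tags zero = s≤s z≤n
    tags (suc zero) = subst (λ z → 1 ≤ hamming ((c z ⊕ eQR) ⊕ (e R ⊕ zeros)) ePQ) (sym q≡L) at-turn₁
    tags (suc (suc zero)) = s≤s z≤n

  -- In the last copy only the main part up to L is needed.
  avoid-in₂ : ∀ k q → suc (suc q) < suc L → Avoids k (B₂ q) (B₂ (suc (suc q)))
  avoid-in₂ k q lt = along (Avoids k) (C₂.B-main q q≤L) (C₂.B-main _ (s≤s⁻¹ lt)) (tags k)
    where
    q≤L = ≤-trans (n≤1+n q) (≤-trans (n≤1+n (suc q)) (s≤s⁻¹ lt))
    tags : ∀ k → Avoids k (t011 ++ (c q ⊕ ePQ)) (t011 ++ (c (suc (suc q)) ⊕ ePQ))
    tags zero = s≤s z≤n
    tags (suc zero) = s≤s z≤n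
    tags (suc (suc zero)) = s≤s z≤n

  -- Seam cases between copies 0 and 1, where the tag of δ 0 is the tag change.
  private
    seam-start : 1 ≤ hamming (ePQR ⊕ (zeros ⊕ e R)) (c 0 ⊕ eQR)
    seam-start rewrite start = differ-P (𝑃𝑄𝑅 ⊕ᵉ (∅ ⊕ᵉ 𝑅)) (∅ ⊕ᵉ 𝑄𝑅) refl

    seam-second : 1 ≤ hamming (eQR ⊕ (zeros ⊕ e R)) (c 1 ⊕ eQR)
    seam-second = ≤-trans (s≤s z≤n) (subst (2 ≤_) moved (nearStart R isR 1 (s≤s z≤n) (s≤s z≤n)))
      where
      moved : hamming (e R) (c 1) ≡ hamming (eQR ⊕ (zeros ⊕ e R)) (c 1 ⊕ eQR)
      moved = trans (cong (λ z → hamming z (c 1)) (solve 𝑅 ((𝑄𝑅 ⊕ᵉ (∅ ⊕ᵉ 𝑅)) ⊕ᵉ 𝑄𝑅) refl))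
                    (hamming-move (eQR ⊕ (zeros ⊕ e R)) (c 1) eQR)

  avoid-seam₀₁ : ∀ k q → suc (suc q) ≡ N → Avoids k (B₀ q) (B₁ 0)
  avoid-seam₀₁ k q q+2≡ = along (Avoids k) (C₀.B-turn₁ (last₂ q q+2≡)) (C₁.B-main 0 z≤n) (tags k)
    where
    tags : ∀ k → Avoids k (t100 ++ ePQR) (t110 ++ (c 0 ⊕ eQR))
    tags zero = seam-start
    tags (suc zero) = s≤s z≤n
    tags (suc (suc zero)) = s≤s z≤n

  avoid-seam₀₁′ : ∀ k q → suc q ≡ N → Avoids k (B₀ q) (B₁ 1)
  avoid-seam₀₁′ k q q+1≡ = along (Avoids k) (C₀.B-turn₂ (last₁ q q+1≡)) (C₁.B-main 1 1≤L) (tags k)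
    where
    tags : ∀ k → Avoids k (t100 ++ eQR) (t110 ++ (c 1 ⊕ eQR))
    tags zero = seam-second
    tags (suc zero) = s≤s z≤n
    tags (suc (suc zero)) = s≤s z≤n

  avoid-seam₁₂ : ∀ k q → suc (suc q) ≡ N → Avoids k (B₁ q) (B₂ 0)
  avoid-seam₁₂ k q q+2≡ = along (Avoids k) (C₁.B-turn₁ (last₂ q q+2≡)) (C₂.B-main 0 z≤n) (tags k)
    where
    tags : ∀ k → Avoids k (t111 ++ e P) (t011 ++ (c 0 ⊕ ePQ))
    tags zero = s≤s z≤n
    tags (suc zero) = s≤s z≤n
    tags (suc (suc zero)) = s≤s z≤n

  avoid-seam₁₂′ : ∀ k q → suc q ≡ N → Avoids k (B₁ q) (B₂ 1)
  avoid-seam₁₂′ k q q+1≡ = along (Avoids k) (C₁.B-turn₂ (last₁ q q+1≡)) (C₂.B-main 1 1≤L) (tags k)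
    where
    tags : ∀ k → Avoids k (t111 ++ ePQ) (t011 ++ (c 1 ⊕ ePQ))
    tags zero = s≤s z≤n
    tags (suc zero) = s≤s z≤n
    tags (suc (suc zero)) = s≤s z≤n

  tripled-avoid : ∀ k p → 2 + p ≤ L′ → Avoids k (W p) (W (2 + p))
  tripled-avoid k p le =
    Offset₂.offset₂ (Avoids k) (suc L) L+1≤N (≤-trans (s≤s (s≤s z≤n)) N≥3)
      (avoid-in₀ k) (avoid-in₁ k) (avoid-in₂ k) (avoid-seam₀₁ k) (avoid-seam₀₁′ k) (avoid-seam₁₂ k) (avoid-seam₁₂′ k)
      p (≤-trans (s≤s le) (≤-reflexive (sym (+-suc (N + N) L))))
    where
    L+1≤N : suc L ≤ N
    L+1≤N = subst (suc L ≤_) (sym N≡3+L) (≤-trans (n≤1+n (suc L)) (n≤1+n (suc (suc L))))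

  private
    in-last-copy : ∀ p → p < L′ → L′ ≤ 2 + p → Σ ℕ λ q → q < L × L ≤ 2 + q × p ≡ N + N + q
    in-last-copy p p<L′ L′≤ = q , q<L , L≤ , sym p≡
      where
      2N≤p : N + N ≤ p
      2N≤p = +-cancelʳ-≤ 2 (N + N) p (≤-trans (+-monoʳ-≤ (N + N) (≤-trans (s≤s (s≤s z≤n)) L≥5)) (≤-trans L′≤ (≤-reflexive (+-comm 2 p))))
      q = p ∸ (N + N)
      p≡ : N + N + q ≡ p
      p≡ = m+[n∸m]≡n 2N≤p
      q<L : q < L
      q<L = +-cancelˡ-< (N + N) q L (subst (_< L′) (sym p≡) p<L′)
      L≤ : L ≤ 2 + q
      L≤ = +-cancelˡ-≤ (N + N) L (2 + q) (≤-trans L′≤ (≤-reflexive (trans (+-comm 2 p)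
             (trans (cong (_+ 2) (sym p≡)) (trans (+-assoc (N + N) q 2) (cong (N + N +_) (+-comm q 2)))))))

    W-end : W L′ ≡ t011 ++ (c L ⊕ ePQ)
    W-end = trans (W₂ L refl) (C₂.B-main L ≤-refl)

  tripled-nearEnd : ∀ y → OneOf P′ Q′ R′ y → ∀ p → p < L′ → L′ ≤ 2 + p → 2 ≤ hamming (W L′ ⊕ e y) (W p)
  tripled-nearEnd y y∈ p p<L′ L′≤ with in-last-copy p p<L′ L′≤
  ... | q , q<L , L≤ , p≡ = along (λ u v → 2 ≤ hamming (u ⊕ e y) v) W-end (trans (W₂ q p≡) (C₂.B-main q (<⇒≤ q<L))) (flips y y∈)
    where
    end-vs-q : 1 ≤ hamming ((c L ⊕ ePQ) ⊕ zeros) (c q ⊕ ePQ)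
    end-vs-q = subst (1 ≤_) (sym (begin
      hamming ((c L ⊕ ePQ) ⊕ zeros) (c q ⊕ ePQ)  ≡⟨ cong (λ z → hamming z (c q ⊕ ePQ)) (⊕-identityʳ (c L ⊕ ePQ)) ⟩
      hamming (c L ⊕ ePQ) (c q ⊕ ePQ)            ≡⟨ hamming-translate (c L) (c q) ePQ ⟩
      hamming (c L) (c q)                        ≡⟨ hamming-sym (c L) (c q) ⟩
      hamming (c q) (c L)                        ∎)) (gap≥1 q L q<L ≤-refl)
      where open ≡-Reasoning
    flipR-vs-q : 2 ≤ hamming ((c L ⊕ ePQ) ⊕ e R) (c q ⊕ ePQ)
    flipR-vs-q = subst (2 ≤_) (sym (begin
      hamming ((c L ⊕ ePQ) ⊕ e R) (c q ⊕ ePQ)    ≡⟨ cong (λ z → hamming z (c q ⊕ ePQ)) (⊕-swap (c L) ePQ (e R)) ⟩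
      hamming ((c L ⊕ e R) ⊕ ePQ) (c q ⊕ ePQ)    ≡⟨ hamming-translate (c L ⊕ e R) (c q) ePQ ⟩
      hamming (c L ⊕ e R) (c q)                  ∎)) (nearEnd R isR q q<L L≤)
      where open ≡-Reasoning
    flips : ∀ y → OneOf P′ Q′ R′ y → 2 ≤ hamming ((t011 ++ (c L ⊕ ePQ)) ⊕ e y) (t011 ++ (c q ⊕ ePQ))
    flips .P′ isP = s≤s end-vs-q
    flips .Q′ isQ = flipR-vs-q
    flips .R′ isR = s≤s end-vs-q

  tripled-nearStart : ∀ y → OneOf P′ Q′ R′ y → ∀ p → 1 ≤ p → p ≤ 2 → 2 ≤ hamming (e y) (W p)
  tripled-nearStart y y∈ p p≥1 p≤2 =
    subst (λ v → 2 ≤ hamming (e y) v) (sym (trans (W₀ p (≤-<-trans p≤2 N≥3)) (C₀.B-main p p≤L))) (flips y y∈)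
    where
    p≤L : p ≤ L
    p≤L = ≤-trans p≤2 (≤-trans (s≤s (s≤s z≤n)) L≥5)
    start-vs-p : 1 ≤ hamming zeros (c p ⊕ zeros)
    start-vs-p = subst (1 ≤_) (cong₂ hamming start (sym (⊕-identityʳ (c p)))) (gap≥1 0 p p≥1 p≤L)
    flipR-vs-p : 2 ≤ hamming (e R) (c p ⊕ zeros)
    flipR-vs-p = subst (2 ≤_) (cong (hamming (e R)) (sym (⊕-identityʳ (c p)))) (nearStart R isR p p≥1 p≤2)
    flips : ∀ y → OneOf P′ Q′ R′ y → 2 ≤ hamming (e y) (t000 ++ (c p ⊕ zeros))
    flips .P′ isP = s≤s start-vs-p
    flips .Q′ isQ = flipR-vs-p
    flips .R′ isR = s≤s start-vs-p

  tripled : Triplable (3 + m) (N + N + N) W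
  tripled = record
    { walk = tripled-walk
    ; L = L′
    ; N≡3+L = 3N≡3+L′
    ; L≥5 = ≤-trans L≥5 (m≤n+m L (N + N))
    ; P = P′ ; Q = Q′ ; R = R′
    ; P≢Q = λ () ; Q≢R = λ () ; P≢R = λ ()
    ; start = trans (W₀ 0 (≤-trans (s≤s z≤n) N≥3)) (trans (C₀.B-main 0 z≤n) (cong (t000 ++_) (trans (⊕-identityʳ (c 0)) start)))
    ; end₀ = trans W-end (cong (t011 ++_) (sym (at-end (_⊕ ePQ) (solve (∅ ⊕ᵉ (𝑅 ⊕ᵉ ∅)) (𝑃𝑄𝑅 ⊕ᵉ 𝑃𝑄) refl))))
    ; end₁ = trans (W₂ (suc L) (sym (+-suc (N + N) L))) (trans (C₂.B-turn₁ refl) (cong (t001 ++_) (sym (⊕-identityʳ (e R)))))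
    ; end₂ = trans (W₂ (suc (suc L)) (sym (trans (+-suc (N + N) (suc L)) (cong suc (+-suc (N + N) L))))) (C₂.B-turn₂ refl)
    ; avoidPQ = tripled-avoid zero
    ; avoidQR = tripled-avoid (suc zero)
    ; avoidPR = tripled-avoid (suc (suc zero))
    ; nearEnd = tripled-nearEnd
    ; nearStart = tripled-nearStart
    }

-- Base cases, verified by evaluation.  A bounded quantifier over ℕ is
-- computed as a boolean; a true outcome yields the property for every
-- index below the bound.

all< : ℕ → (ℕ → Bool) → Bool
all< zero f = true
all< (suc n) f = f n ∧ all< n f

all<-sound : ∀ n f → T (all< n f) → ∀ i → i < n → T (f i)
all<-sound (suc n) f holds i i<n with i ≟ n
... | yes refl = proj₁ (Equivalence.to T-∧ holds)
... | no i≢n = all<-sound n f (proj₂ (Equivalence.to (T-∧ {f n}) holds)) i (≤∧≢⇒< (s≤s⁻¹ i<n) i≢n)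

_⇒ᵇ_ : Bool → Bool → Bool
true ⇒ᵇ b = b
false ⇒ᵇ b = true

⇒ᵇ-sound : ∀ {a b} → T (a ⇒ᵇ b) → T a → T b
⇒ᵇ-sound {true} holds _ = holds

Forall : ℕ → (ℕ → Bool) → (ℕ → Bool) → Bool
Forall n cond prop = all< n (λ i → cond i ⇒ᵇ prop i)

Forall-sound : ∀ n cond prop → T (Forall n cond prop) → ∀ i → i < n → T (cond i) → T (prop i)
Forall-sound n cond prop holds i i<n = ⇒ᵇ-sound (all<-sound n _ holds i i<n)

∧-intro : ∀ {a b} → T a → T b → T (a ∧ b)
∧-intro ta tb = Equivalence.from T-∧ (ta , tb)

module CodeWalkByEvaluation {m : ℕ} (N : ℕ) (c : ℕ → Vertex m) where
  private
    has-step₁ has-step₂ : ℕ → Bool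
    has-step₁ p = suc p <ᵇ N
    has-step₂ p = suc (suc p) <ᵇ N
    step₁-ok step₂-ok : ℕ → Bool
    step₁-ok p = hamming (c p) (c (suc p)) ≡ᵇ 1
    step₂-ok p = hamming (c p) (c (suc (suc p))) ≡ᵇ 2
    far-pair : ℕ → ℕ → Bool
    far-pair i d = (3 ≤ᵇ d) ∧ ((d + 3 ≤ᵇ N) ∧ (i + d <ᵇ N))
    spread-ok : ℕ → ℕ → Bool
    spread-ok i d = 3 ≤ᵇ hamming (c i) (c (i + d))

  steps₁ steps₂ spreads : Bool
  steps₁ = Forall N has-step₁ step₁-ok
  steps₂ = Forall N has-step₂ step₂-ok
  spreads = all< N λ i → Forall N (far-pair i) (spread-ok i)

  codeWalk : 6 ≤ N → T steps₁ → T steps₂ → T spreads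
    → T (hamming (c (pred N)) (c 0) ≡ᵇ 1)
    → T (hamming (c (pred (pred N))) (c 0) ≡ᵇ 2)
    → T (hamming (c (pred N)) (c 1) ≡ᵇ 2)
    → CodeWalk N c
  codeWalk long s₁ s₂ sp c₁ c₂ c₂′ = record
    { long = long
    ; step₁ = λ p lt → ≡ᵇ⇒≡ _ _ (Forall-sound N has-step₁ step₁-ok s₁ p (<-trans (n<1+n p) lt) (<⇒<ᵇ lt))
    ; step₂ = λ p lt → ≡ᵇ⇒≡ _ _ (Forall-sound N has-step₂ step₂-ok s₂ p (<-trans (n<1+n p) (<-trans (n<1+n (suc p)) lt)) (<⇒<ᵇ lt))
    ; spread = λ i d d≥3 room lt → ≤ᵇ⇒≤ 3 _ (Forall-sound N (far-pair i) (spread-ok i)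
                 (all<-sound N (λ i → Forall N (far-pair i) (spread-ok i)) sp i (≤-<-trans (m≤m+n i d) lt)) d
                 (≤-<-trans (m≤n+m d i) lt) (∧-intro (≤⇒≤ᵇ d≥3) (∧-intro (≤⇒≤ᵇ room) (<⇒<ᵇ lt))))
    ; close₁ = λ i i+1≡ → subst (λ z → hamming (c z) (c 0) ≡ 1) (sym (cong pred i+1≡)) (≡ᵇ⇒≡ _ _ c₁)
    ; close₂ = λ i i+2≡ → subst (λ z → hamming (c z) (c 0) ≡ 2) (sym (cong (λ z → pred (pred z)) i+2≡)) (≡ᵇ⇒≡ _ _ c₂)
    ; close₂′ = λ i i+1≡ → subst (λ z → hamming (c z) (c 1) ≡ 2) (sym (cong pred i+1≡)) (≡ᵇ⇒≡ _ _ c₂′)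
    }

module TriplableByEvaluation {m : ℕ} (N L : ℕ) (c : ℕ → Vertex m) (P Q R : Fin m) where
  private
    two-step-within near-end near-start : ℕ → Bool
    two-step-within q = 2 + q ≤ᵇ L
    near-end q = (q <ᵇ L) ∧ (L ≤ᵇ 2 + q)
    near-start q = (1 ≤ᵇ q) ∧ (q ≤ᵇ 2)
    avoid-ok : Vertex m → ℕ → Bool
    avoid-ok δ q = 1 ≤ᵇ hamming (c q ⊕ δ) (c (2 + q))
    end-ok start-ok : Fin m → ℕ → Bool
    end-ok y q = 2 ≤ᵇ hamming (c L ⊕ e y) (c q)
    start-ok y q = 2 ≤ᵇ hamming (e y) (c q)

  avoids : Vertex m → Bool
  avoids δ = Forall N two-step-within (avoid-ok δ)

  nearEnds nearStarts : Fin m → Bool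
  nearEnds y = Forall N near-end (end-ok y)
  nearStarts y = Forall N near-start (start-ok y)

  module _ (L<N : L < N) where
    private
      avoid : ∀ δ → T (avoids δ) → ∀ q → 2 + q ≤ L → 1 ≤ hamming (c q ⊕ δ) (c (2 + q))
      avoid δ holds q le = ≤ᵇ⇒≤ 1 _ (Forall-sound N two-step-within (avoid-ok δ) holds q (≤-<-trans (≤-trans (m≤n+m q 2) le) L<N) (≤⇒≤ᵇ le))

      nearEnd : ∀ y → T (nearEnds y) → ∀ q → q < L → L ≤ 2 + q → 2 ≤ hamming (c L ⊕ e y) (c q)
      nearEnd y holds q q<L le = ≤ᵇ⇒≤ 2 _ (Forall-sound N near-end (end-ok y) holds q (<-trans q<L L<N) (∧-intro (<⇒<ᵇ q<L) (≤⇒≤ᵇ le)))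

      nearStart : ∀ y → T (nearStarts y) → 2 < N → ∀ q → 1 ≤ q → q ≤ 2 → 2 ≤ hamming (e y) (c q)
      nearStart y holds 2<N q q≥1 q≤2 = ≤ᵇ⇒≤ 2 _ (Forall-sound N near-start (start-ok y) holds q (≤-<-trans q≤2 2<N) (∧-intro (≤⇒≤ᵇ q≥1) (≤⇒≤ᵇ q≤2)))
    triplable : (walk : CodeWalk N c) → N ≡ 3 + L → 5 ≤ L
      → ¬ P ≡ Q → ¬ Q ≡ R → ¬ P ≡ R
      → c 0 ≡ zeros → c L ≡ e P ⊕ (e Q ⊕ e R) → c (suc L) ≡ e Q ⊕ e R → c (suc (suc L)) ≡ e R
      → T (avoids (e P ⊕ e Q)) → T (avoids (e Q ⊕ e R)) → T (avoids (e P ⊕ e R))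
      → T (nearEnds P) → T (nearEnds Q) → T (nearEnds R)
      → T (nearStarts P) → T (nearStarts Q) → T (nearStarts R)
      → Triplable m N c
    triplable walk N≡ L≥5 P≢Q Q≢R P≢R c₀ c₁ c₂ c₃ aPQ aQR aPR eP eQ eR sP sQ sR = record
      { walk = walk ; L = L ; N≡3+L = N≡ ; L≥5 = L≥5 ; P = P ; Q = Q ; R = R
      ; P≢Q = P≢Q ; Q≢R = Q≢R ; P≢R = P≢R
      ; start = c₀ ; end₀ = c₁ ; end₁ = c₂ ; end₂ = c₃
      ; avoidPQ = avoid _ aPQ ; avoidQR = avoid _ aQR ; avoidPR = avoid _ aPR
      ; nearEnd = λ { .P isP → nearEnd P eP ; .Q isQ → nearEnd Q eQ ; .R isR → nearEnd R eR }
      ; nearStart = λ { .P isP → nearStart P sP 2<N ; .Q isQ → nearStart Q sQ 2<N ; .R isR → nearStart R sR 2<N }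
      }
      where
      2<N : 2 < N
      2<N = ≤-<-trans (≤-trans (s≤s (s≤s z≤n)) L≥5) L<N

-- The base walks.  Vertices are given by their binary codes (least
-- significant bit first), walks by the list of codes of their positions.

toVertex : ∀ m → ℕ → Vertex m
toVertex zero k = []
toVertex (suc m) k = (k % 2 ≡ᵇ 1) ∷ toVertex m (k / 2)

at : List ℕ → ℕ → ℕ
at [] i = 0
at (k ∷ ks) zero = k
at (k ∷ ks) (suc i) = at ks i

walkOf : ∀ m → List ℕ → ℕ → Vertex m
walkOf m codes i = toVertex m (at codes i)

c₁₆ : ℕ → Vertex 6
c₁₆ = walkOf 6 (0 ∷ 1 ∷ 3 ∷ 7 ∷ 15 ∷ 14 ∷ 30 ∷ 26 ∷ 58 ∷ 59 ∷ 57 ∷ 61 ∷ 53 ∷ 52 ∷ 36 ∷ 32 ∷ [])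

c₂₄ : ℕ → Vertex 7
c₂₄ = walkOf 7
  ( 0 ∷ 1 ∷ 3 ∷ 7 ∷ 15 ∷ 14 ∷ 30 ∷ 62 ∷ 60 ∷ 61 ∷ 53 ∷ 117 ∷
    101 ∷ 100 ∷ 102 ∷ 98 ∷ 106 ∷ 107 ∷ 123 ∷ 91 ∷ 89 ∷ 88 ∷ 80 ∷ 16 ∷ [])

c₃₂ : ℕ → Vertex 8
c₃₂ = walkOf 8
  ( 0 ∷ 1 ∷ 3 ∷ 7 ∷ 15 ∷ 14 ∷ 30 ∷ 28 ∷ 60 ∷ 61 ∷ 57 ∷ 59 ∷
    123 ∷ 122 ∷ 106 ∷ 98 ∷ 102 ∷ 100 ∷ 228 ∷ 236 ∷ 204 ∷ 205 ∷ 221 ∷ 223 ∷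
    215 ∷ 247 ∷ 183 ∷ 182 ∷ 178 ∷ 176 ∷ 144 ∷ 128 ∷ [])

c₄₈ : ℕ → Vertex 9
c₄₈ = walkOf 9
  ( 0 ∷ 1 ∷ 3 ∷ 7 ∷ 15 ∷ 14 ∷ 30 ∷ 28 ∷ 60 ∷ 61 ∷ 57 ∷ 59 ∷
    123 ∷ 122 ∷ 114 ∷ 112 ∷ 240 ∷ 241 ∷ 245 ∷ 247 ∷ 231 ∷ 230 ∷ 238 ∷ 236 ∷
    204 ∷ 205 ∷ 201 ∷ 203 ∷ 459 ∷ 458 ∷ 450 ∷ 466 ∷ 470 ∷ 342 ∷ 343 ∷ 341 ∷
    277 ∷ 405 ∷ 413 ∷ 415 ∷ 447 ∷ 446 ∷ 442 ∷ 440 ∷ 424 ∷ 416 ∷ 288 ∷ 256 ∷ [])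

c₇₂ : ℕ → Vertex 10
c₇₂ = walkOf 10
  ( 0 ∷ 1 ∷ 3 ∷ 7 ∷ 15 ∷ 14 ∷ 30 ∷ 28 ∷ 60 ∷ 61 ∷ 57 ∷ 59 ∷
    123 ∷ 122 ∷ 114 ∷ 112 ∷ 240 ∷ 241 ∷ 245 ∷ 247 ∷ 231 ∷ 230 ∷ 238 ∷ 236 ∷
    204 ∷ 205 ∷ 201 ∷ 203 ∷ 459 ∷ 458 ∷ 450 ∷ 448 ∷ 960 ∷ 961 ∷ 965 ∷ 967 ∷
    983 ∷ 982 ∷ 990 ∷ 988 ∷ 1020 ∷ 1021 ∷ 1017 ∷ 1019 ∷ 955 ∷ 954 ∷ 946 ∷ 930 ∷
    934 ∷ 932 ∷ 420 ∷ 436 ∷ 404 ∷ 405 ∷ 277 ∷ 789 ∷ 797 ∷ 793 ∷ 777 ∷ 809 ∷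
    808 ∷ 872 ∷ 874 ∷ 878 ∷ 879 ∷ 623 ∷ 621 ∷ 613 ∷ 612 ∷ 580 ∷ 516 ∷ 512 ∷ [])

walk₁₆ : CodeWalk 16 c₁₆
walk₁₆ = CodeWalkByEvaluation.codeWalk 16 c₁₆ (≤ᵇ⇒≤ 6 16 tt) tt tt tt tt tt tt

walk₂₄ : CodeWalk 24 c₂₄
walk₂₄ = CodeWalkByEvaluation.codeWalk 24 c₂₄ (≤ᵇ⇒≤ 6 24 tt) tt tt tt tt tt tt

triplable₃₂ : Triplable 8 32 c₃₂
triplable₃₂ = TriplableByEvaluation.triplable 32 29 c₃₂ (# 5) (# 4) (# 7) (≤ᵇ⇒≤ 30 32 tt)
  (CodeWalkByEvaluation.codeWalk 32 c₃₂ (≤ᵇ⇒≤ 6 32 tt) tt tt tt tt tt tt) refl (≤ᵇ⇒≤ 5 29 tt)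
  (λ ()) (λ ()) (λ ()) refl refl refl refl tt tt tt tt tt tt tt tt tt

triplable₄₈ : Triplable 9 48 c₄₈
triplable₄₈ = TriplableByEvaluation.triplable 48 45 c₄₈ (# 7) (# 5) (# 8) (≤ᵇ⇒≤ 46 48 tt)
  (CodeWalkByEvaluation.codeWalk 48 c₄₈ (≤ᵇ⇒≤ 6 48 tt) tt tt tt tt tt tt) refl (≤ᵇ⇒≤ 5 45 tt)
  (λ ()) (λ ()) (λ ()) refl refl refl refl tt tt tt tt tt tt tt tt tt

triplable₇₂ : Triplable 10 72 c₇₂
triplable₇₂ = TriplableByEvaluation.triplable 72 69 c₇₂ (# 6) (# 2) (# 9) (≤ᵇ⇒≤ 70 72 tt)
  (CodeWalkByEvaluation.codeWalk 72 c₇₂ (≤ᵇ⇒≤ 6 72 tt) tt tt tt tt tt tt) refl (≤ᵇ⇒≤ 5 69 tt)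
  (λ ()) (λ ()) (λ ()) refl refl refl refl tt tt tt tt tt tt tt tt tt

-- The length bounds of the theorem with the cube roots cleared:
-- 32·3^((n-8)/3) ≤ N ≤ (24/22)·32·3^((n-8)/3).
LengthBounds : ℕ → ℕ → Set
LengthBounds n N = (32 ^ 3 * 3 ^ n ≤ N ^ 3 * 3 ^ 8) × ((22 * N) ^ 3 * 3 ^ 8 ≤ (24 * 32) ^ 3 * 3 ^ n)

-- Both bounds scale by 27 when n grows by 3 and N triples.
bounds-triple : ∀ n N → LengthBounds n N → LengthBounds (3 + n) (N + N + N)
bounds-triple n N (lower , upper) =
  subst₂ _≤_ (sym (power-triple 32 n)) (sym (length-triple N (3 ^ 8))) (*-monoʳ-≤ 27 lower) ,
  subst₂ _≤_ (sym (scaled-length-triple 22 N (3 ^ 8))) (sym (power-triple (24 * 32) n)) (*-monoʳ-≤ 27 upper)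
  where
  -- The ring solver does not reflect _^_, so the cubes are expanded.
  power-triple : ∀ a n → a ^ 3 * 3 ^ (3 + n) ≡ 27 * (a ^ 3 * 3 ^ n)
  power-triple a n = expanded a (3 ^ n)
    where
    expanded : ∀ a x → a * (a * (a * 1)) * (3 * (3 * (3 * x))) ≡ 27 * (a * (a * (a * 1)) * x)
    expanded = solve-∀
  length-triple : ∀ N x → (N + N + N) ^ 3 * x ≡ 27 * (N ^ 3 * x)
  length-triple = expanded
    where
    expanded : ∀ N x → (N + N + N) * ((N + N + N) * ((N + N + N) * 1)) * x ≡ 27 * (N * (N * (N * 1)) * x)
    expanded = solve-∀
  scaled-length-triple : ∀ a N x → (a * (N + N + N)) ^ 3 * x ≡ 27 * ((a * N) ^ 3 * x)
  scaled-length-triple = expanded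
    where
    expanded : ∀ a N x → a * (N + N + N) * (a * (N + N + N) * (a * (N + N + N) * 1)) * x ≡ 27 * (a * N * (a * N * (a * N * 1)) * x)
    expanded = solve-∀

Seeded : ℕ → Set
Seeded n = Σ ℕ λ N → Σ (ℕ → Vertex n) λ c → Triplable n N c × LengthBounds n N

triple : ∀ n → Seeded n → Seeded (3 + n)
triple n (N , c , T , bounds) = N + N + N , Tripling.W T , Tripling.tripled T , bounds-triple n N bounds

seeded : ∀ k → Seeded (8 + k)
seeded 0 = 32 , c₃₂ , triplable₃₂ , ≤ᵇ⇒≤ _ _ tt , ≤ᵇ⇒≤ _ _ tt
seeded 1 = 48 , c₄₈ , triplable₄₈ , ≤ᵇ⇒≤ _ _ tt , ≤ᵇ⇒≤ _ _ tt
seeded 2 = 72 , c₇₂ , triplable₇₂ , ≤ᵇ⇒≤ _ _ tt , ≤ᵇ⇒≤ _ _ tt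
seeded (suc (suc (suc k))) = triple (8 + k) (seeded k)

BoundedCodeWalk : ℕ → Set
BoundedCodeWalk n = Σ ℕ λ N → Σ (ℕ → Vertex n) λ c → CodeWalk N c × LengthBounds n N

forget-seed : ∀ {n} → Seeded n → BoundedCodeWalk n
forget-seed (N , c , T , bounds) = N , c , Triplable.walk T , bounds

bounded-code-walk : ∀ m → BoundedCodeWalk (6 + m)
bounded-code-walk 0 = 16 , c₁₆ , walk₁₆ , ≤ᵇ⇒≤ _ _ tt , ≤ᵇ⇒≤ _ _ tt
bounded-code-walk 1 = 24 , c₂₄ , walk₂₄ , ≤ᵇ⇒≤ _ _ tt , ≤ᵇ⇒≤ _ _ tt
bounded-code-walk (suc (suc k)) = forget-seed (seeded k)

circuit-code : ∀ {n} → BoundedCodeWalk n → Σ ℕ (λ N → Σ (Fin N → Vertex n) (λ x → IsCircuitCode n 3 N x × LengthBounds n N))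
circuit-code (N , c , walk , bounds) = N , (λ i → c (toℕ i)) , CodeWalkToCode.codeWalk⇒circuitCode walk , bounds

lemma4 : (n : ℕ) → 6 ≤ n →
    Σ ℕ (λ N → Σ (Fin N → Vertex n) (λ x →
      IsCircuitCode n 3 N x ×
      (32 ^ 3 * 3 ^ n ≤ N ^ 3 * 3 ^ 8) ×
      ((22 * N) ^ 3 * 3 ^ 8 ≤ (24 * 32) ^ 3 * 3 ^ n)))
lemma4 _ (s≤s (s≤s (s≤s (s≤s (s≤s (s≤s {n = m} _)))))) = circuit-code (bounded-code-walk m)
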